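{- Let $n\ge 1$. For every bipartite graph $G$ on $n$ vertices, $\mathrm{pn}(G)\le \mathrm{pn}(K_{\lceil n/2\rceil,\lfloor n/2\rfloor})$, and equality holds only if $G$ is (isomorphic to) the complete bipartite graph $K_{\lceil n/2\rceil,\lfloor n/2\rfloor}$.
   Context: All graphs are finite and simple. For a graph $G$, the subpath number $\mathrm{pn}(G)$ is the number of paths (as subgraphs, i.e. unordered) in $G$, including the trivial paths of length $0$ (single vertices). $K_{a,b}$ denotes the complete bipartite graph with partite sets of sizes $a$ and $b$. -}

module Defs where

open import Data.Bool using (Bool; true; false; _∧_; _∨_; not; _xor_; if_then_else_)
open import Data.Nat using (ℕ; zero; suc; _+_; _<ᵇ_; _≤_; ⌈_/2⌉)
open import Data.Fin using (Fin; toℕ; _≟_)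
open import Data.List using (List; []; _∷_; map; concatMap; length; filter; allFin; applyUpTo)
open import Data.Nat.ListAction using (sum)
open import Data.Product using (Σ; _×_; _,_)
open import Relation.Binary.PropositionalEquality using (_≡_; _≢_)
open import Relation.Nullary.Decidable using (⌊_⌋)
open import Function.Bundles using (_↔_)

record Graph (n : ℕ) : Set where
  field
    adj    : Fin n → Fin n → Bool
    sym    : ∀ u v → adj u v ≡ adj v u
    irrefl : ∀ v → adj v v ≡ false
open Graph public

Bipartite : ∀ {n} → Graph n → Set
Bipartite {n} G = Σ (Fin n → Bool) λ c → ∀ u v → adj G u v ≡ true → c u ≢ c v

_≅_ : ∀ {n} → Graph n → Graph n → Set
_≅_ {n} G H = Σ (Fin n ↔ Fin n) λ f → ∀ u v → adj G u v ≡ adj H (Function.Bundles.Inverse.to f u) (Function.Bundles.Inverse.to f v)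

-- Complete bipartite graph K_{a, n-a} on Fin n: parts {i | i < a} and {i | i ≥ a}.
KBip : (n a : ℕ) → Graph n
KBip n a = record { adj = λ u v → (toℕ u <ᵇ a) xor (toℕ v <ᵇ a)
                  ; sym = λ u v → xor-comm (toℕ u <ᵇ a) (toℕ v <ᵇ a)
                  ; irrefl = λ v → xor-self (toℕ v <ᵇ a) }
  where
  open import Relation.Binary.PropositionalEquality using (refl)
  xor-comm : ∀ x y → x xor y ≡ y xor x
  xor-comm true true = refl
  xor-comm true false = refl
  xor-comm false true = refl
  xor-comm false false = refl
  xor-self : ∀ x → x xor x ≡ false
  xor-self true = refl
  xor-self false = refl

Kbal : (n : ℕ) → Graph n
Kbal n = KBip n ⌈ n /2⌉

listsOfLength : ∀ {n} → ℕ → List (List (Fin n))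
listsOfLength zero = [] ∷ []
listsOfLength {n} (suc k) = concatMap (λ xs → map (_∷ xs) (allFin n)) (listsOfLength k)

elem : ∀ {n} → Fin n → List (Fin n) → Bool
elem x [] = false
elem x (y ∷ ys) = ⌊ x ≟ y ⌋ ∨ elem x ys

distinct : ∀ {n} → List (Fin n) → Bool
distinct [] = true
distinct (x ∷ xs) = not (elem x xs) ∧ distinct xs

walkB : ∀ {n} → Graph n → List (Fin n) → Bool
walkB G [] = true
walkB G (x ∷ []) = true
walkB G (x ∷ y ∷ ys) = adj G x y ∧ walkB G (y ∷ ys)

lastOr : ∀ {n} → Fin n → List (Fin n) → Fin n
lastOr d [] = d
lastOr d (x ∷ xs) = lastOr x xs

-- Every path (as a subgraph) with ≥ 1 edge has exactly two vertex sequences,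
-- exactly one of which is canonical; a trivial path has one sequence.
canonical : ∀ {n} → List (Fin n) → Bool
canonical [] = false
canonical (x ∷ []) = true
canonical (x ∷ y ∷ ys) = toℕ x <ᵇ toℕ (lastOr y ys)

isCanonPath : ∀ {n} → Graph n → List (Fin n) → Bool
isCanonPath G xs = distinct xs ∧ walkB G xs ∧ canonical xs

-- Subpath number: number of paths in G (unordered, including trivial ones).
-- A path has between 1 and n vertices.
pn : ∀ {n} → Graph n → ℕ
pn {n} G = sum (applyUpTo (λ k → length (filter (λ xs → isCanonPath G xs ≟B true) (listsOfLength (suc k)))) n)
  where
  open import Data.Bool.Properties renaming (_≟_ to _≟B_)

-- Properly 2-colour G with classes of sizes p + q = n. Then G is a spanning subgraph of the
-- complete bipartite graph K on these classes, so for each k it has at most as many paths on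
-- k + 1 vertices as K. A path with at least two vertices has exactly two vertex sequences, and
-- the sequences of K are counted by the start colour: p q (p - 1) (q - 1) ⋯ and q p (q - 1) (p - 1) ⋯.
-- Grouped in pairs these are products of factors (p - i) (q - i) ≤ (⌈n/2⌉ - i) (⌊n/2⌋ - i), so the
-- balanced K_{⌈n/2⌉,⌊n/2⌋} has at least as many paths of each length, whence the bound. If equality
-- holds, it holds for the number of edges: G contains every edge of K, and p q = ⌈n/2⌉ ⌊n/2⌋ forces
-- {p, q} = {⌈n/2⌉, ⌊n/2⌋}, so that K is isomorphic to K_{⌈n/2⌉,⌊n/2⌋}.
module Submission where

open import Defs hiding (sym)
open import Data.Bool using (Bool; true; false; _∧_; _∨_; not; _xor_; if_then_else_)
open import Data.Bool.Properties
  using (∧-identityʳ; ∧-zeroʳ; ∧-assoc; ∧-comm; ∨-comm; ∨-assoc; ∨-identityʳ; ∨-zeroʳ; xor-comm; xor-same;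
         not-distribˡ-xor; not-distribʳ-xor; not-involutive; T-≡)
  renaming (_≟_ to _≟ᵇ_)
open import Data.Bool.Solver using (module xor-∧-Solver)
open import Data.Nat using (ℕ; zero; suc; _+_; _*_; _∸_; _≤_; _<_; z≤n; s≤s; _≤?_; _<ᵇ_; ⌈_/2⌉; ⌊_/2⌋)
open import Data.Nat.Properties hiding (_≟_)
open import Data.Nat.Tactic.RingSolver using (solve-∀)
open import Data.Nat.ListAction using (sum)
open import Data.Fin using (Fin; toℕ; fromℕ<; punchOut; _≟_) renaming (zero to fzero; suc to fsuc)
open import Data.Fin.Properties using (toℕ-injective; toℕ-fromℕ<; any?; punchOut-injective; injective⇒≤)
open import Data.List
  using (List; []; _∷_; _++_; _∷ʳ_; map; concatMap; length; filter; allFin; applyUpTo; reverse)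
open import Data.List.Properties
  using (map-tabulate; length-tabulate; unfold-reverse; reverse-involutive; length-reverse)
open import Data.Product using (Σ-syntax; _×_; _,_; proj₁; proj₂)
open import Data.Sum using (_⊎_; inj₁; inj₂)
open import Data.Empty using (⊥-elim)
open import Function using (_∘_; case_of_; Equivalence)
open import Function.Bundles using (_↔_; mk↔ₛ′; Inverse)
open import Relation.Binary using (tri<; tri≈; tri>)
open import Relation.Binary.PropositionalEquality
open import Relation.Nullary using (yes; no; ¬_)
open import Relation.Nullary.Decidable using (⌊_⌋)

-- Balanced splittings in ℕ

⌊m+[m+n]/2⌋≡m+⌊n/2⌋ : ∀ m n → ⌊ m + (m + n) /2⌋ ≡ m + ⌊ n /2⌋
⌊m+[m+n]/2⌋≡m+⌊n/2⌋ zero    n = refl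
⌊m+[m+n]/2⌋≡m+⌊n/2⌋ (suc m) n =
  trans (cong (λ k → ⌊ suc k /2⌋) (+-suc m (m + n))) (cong suc (⌊m+[m+n]/2⌋≡m+⌊n/2⌋ m n))

⌈m+[m+n]/2⌉≡m+⌈n/2⌉ : ∀ m n → ⌈ m + (m + n) /2⌉ ≡ m + ⌈ n /2⌉
⌈m+[m+n]/2⌉≡m+⌈n/2⌉ m n = trans (cong ⌊_/2⌋ 1+m+[m+n]≡m+[m+[1+n]]) (⌊m+[m+n]/2⌋≡m+⌊n/2⌋ m (suc n))
  where
  1+m+[m+n]≡m+[m+[1+n]] : suc (m + (m + n)) ≡ m + (m + suc n)
  1+m+[m+n]≡m+[m+[1+n]] = sym (trans (cong (m +_) (+-suc m n)) (+-suc m (m + n)))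

⌈n/2⌉+⌊n/2⌋≡n : ∀ n → ⌈ n /2⌉ + ⌊ n /2⌋ ≡ n
⌈n/2⌉+⌊n/2⌋≡n n = trans (+-comm ⌈ n /2⌉ ⌊ n /2⌋) (⌊n/2⌋+⌈n/2⌉≡n n)

m+m≤n+n⇒m≤n : ∀ {m n} → m + m ≤ n + n → m ≤ n
m+m≤n+n⇒m≤n {m} {n} le = subst₂ _≤_ (sym (n≡⌊n+n/2⌋ m)) (sym (n≡⌊n+n/2⌋ n)) (⌊n/2⌋-mono le)

m+m≡n+n⇒m≡n : ∀ {m n} → m + m ≡ n + n → m ≡ n
m+m≡n+n⇒m≡n {m} {n} eq = trans (n≡⌊n+n/2⌋ m) (trans (cong ⌊_/2⌋ eq) (sym (n≡⌊n+n/2⌋ n)))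

-- AM-GM in ℕ, with the exact defect.
⌈m+[m+d]/2⌉*⌊m+[m+d]/2⌋≡m*[m+d]+⌈d/2⌉*⌊d/2⌋ : ∀ m d →
  ⌈ m + (m + d) /2⌉ * ⌊ m + (m + d) /2⌋ ≡ m * (m + d) + ⌈ d /2⌉ * ⌊ d /2⌋
⌈m+[m+d]/2⌉*⌊m+[m+d]/2⌋≡m*[m+d]+⌈d/2⌉*⌊d/2⌋ m d = begin
  ⌈ m + (m + d) /2⌉ * ⌊ m + (m + d) /2⌋
    ≡⟨ cong₂ _*_ (⌈m+[m+n]/2⌉≡m+⌈n/2⌉ m d) (⌊m+[m+n]/2⌋≡m+⌊n/2⌋ m d) ⟩
  (m + ⌈ d /2⌉) * (m + ⌊ d /2⌋)
    ≡⟨ expand m ⌈ d /2⌉ ⌊ d /2⌋ ⟩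
  m * (m + (⌈ d /2⌉ + ⌊ d /2⌋)) + ⌈ d /2⌉ * ⌊ d /2⌋
    ≡⟨ cong (λ e → m * (m + e) + ⌈ d /2⌉ * ⌊ d /2⌋) (⌈n/2⌉+⌊n/2⌋≡n d) ⟩
  m * (m + d) + ⌈ d /2⌉ * ⌊ d /2⌋ ∎
  where
  open ≡-Reasoning
  expand : ∀ m u v → (m + u) * (m + v) ≡ m * (m + (u + v)) + u * v
  expand = solve-∀

m≤n⇒m*n≤⌈m+n/2⌉*⌊m+n/2⌋ : ∀ {m n} → m ≤ n → m * n ≤ ⌈ m + n /2⌉ * ⌊ m + n /2⌋
m≤n⇒m*n≤⌈m+n/2⌉*⌊m+n/2⌋ {m} {n} m≤n with d ← n ∸ m | refl ← m+[n∸m]≡n m≤n =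
  subst (m * (m + d) ≤_) (sym (⌈m+[m+d]/2⌉*⌊m+[m+d]/2⌋≡m*[m+d]+⌈d/2⌉*⌊d/2⌋ m d)) (m≤m+n _ _)

*≤⌈m+n/2⌉*⌊m+n/2⌋ : ∀ m n → m * n ≤ ⌈ m + n /2⌉ * ⌊ m + n /2⌋
*≤⌈m+n/2⌉*⌊m+n/2⌋ m n with ≤-total m n
... | inj₁ m≤n = m≤n⇒m*n≤⌈m+n/2⌉*⌊m+n/2⌋ m≤n
... | inj₂ n≤m = subst₂ _≤_ (*-comm n m) (cong (λ s → ⌈ s /2⌉ * ⌊ s /2⌋) (+-comm n m))
                        (m≤n⇒m*n≤⌈m+n/2⌉*⌊m+n/2⌋ n≤m)

m≤n∧m*n≡⌈m+n/2⌉*⌊m+n/2⌋⇒balanced : ∀ {m n} → m ≤ n → m * n ≡ ⌈ m + n /2⌉ * ⌊ m + n /2⌋ →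
  m ≡ ⌈ m + n /2⌉ ⊎ m ≡ ⌊ m + n /2⌋
m≤n∧m*n≡⌈m+n/2⌉*⌊m+n/2⌋⇒balanced {m} {n} m≤n eq with d ← n ∸ m | refl ← m+[n∸m]≡n m≤n
  with m*n≡0⇒m≡0∨n≡0 ⌈ d /2⌉ (sym defect≡0)
  where
  defect≡0 : 0 ≡ ⌈ d /2⌉ * ⌊ d /2⌋
  defect≡0 = +-cancelˡ-≡ (m * (m + d)) 0 _
    (trans (+-identityʳ _) (trans eq (⌈m+[m+d]/2⌉*⌊m+[m+d]/2⌋≡m*[m+d]+⌈d/2⌉*⌊d/2⌋ m d)))
... | inj₁ ⌈d/2⌉≡0 = inj₁ (sym (trans (⌈m+[m+n]/2⌉≡m+⌈n/2⌉ m d) (trans (cong (m +_) ⌈d/2⌉≡0) (+-identityʳ m))))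
... | inj₂ ⌊d/2⌋≡0 = inj₂ (sym (trans (⌊m+[m+n]/2⌋≡m+⌊n/2⌋ m d) (trans (cong (m +_) ⌊d/2⌋≡0) (+-identityʳ m))))

n≡⌈m+n/2⌉⇒m≡⌊m+n/2⌋ : ∀ m n → n ≡ ⌈ m + n /2⌉ → m ≡ ⌊ m + n /2⌋
n≡⌈m+n/2⌉⇒m≡⌊m+n/2⌋ m n n≡⌈⌉ =
  +-cancelʳ-≡ n m ⌊ m + n /2⌋ (trans (sym (⌊n/2⌋+⌈n/2⌉≡n (m + n))) (cong (⌊ m + n /2⌋ +_) (sym n≡⌈⌉)))

n≡⌊m+n/2⌋⇒m≡⌈m+n/2⌉ : ∀ m n → n ≡ ⌊ m + n /2⌋ → m ≡ ⌈ m + n /2⌉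
n≡⌊m+n/2⌋⇒m≡⌈m+n/2⌉ m n n≡⌊⌋ =
  +-cancelʳ-≡ n m ⌈ m + n /2⌉ (trans (sym (⌈n/2⌉+⌊n/2⌋≡n (m + n))) (cong (⌈ m + n /2⌉ +_) (sym n≡⌊⌋)))

m*n≡⌈m+n/2⌉*⌊m+n/2⌋⇒balanced : ∀ m n → m * n ≡ ⌈ m + n /2⌉ * ⌊ m + n /2⌋ →
  m ≡ ⌈ m + n /2⌉ ⊎ m ≡ ⌊ m + n /2⌋
m*n≡⌈m+n/2⌉*⌊m+n/2⌋⇒balanced m n eq with ≤-total m n
... | inj₁ m≤n = m≤n∧m*n≡⌈m+n/2⌉*⌊m+n/2⌋⇒balanced m≤n eq
... | inj₂ n≤m with m≤n∧m*n≡⌈m+n/2⌉*⌊m+n/2⌋⇒balanced n≤m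
                     (trans (*-comm n m) (trans eq (cong (λ s → ⌈ s /2⌉ * ⌊ s /2⌋) (+-comm m n))))
...   | inj₁ n≡⌈⌉ = inj₂ (n≡⌈m+n/2⌉⇒m≡⌊m+n/2⌋ m n (trans n≡⌈⌉ (cong ⌈_/2⌉ (+-comm n m))))
...   | inj₂ n≡⌊⌋ = inj₁ (n≡⌊m+n/2⌋⇒m≡⌈m+n/2⌉ m n (trans n≡⌊⌋ (cong ⌊_/2⌋ (+-comm n m))))

m+n≡i+[i+[[m∸i]+[n∸i]]] : ∀ {i m n} → i ≤ m → i ≤ n → m + n ≡ i + (i + ((m ∸ i) + (n ∸ i)))
m+n≡i+[i+[[m∸i]+[n∸i]]] {i} {m} {n} i≤m i≤n =
  trans (sym (cong₂ _+_ (m+[n∸m]≡n i≤m) (m+[n∸m]≡n i≤n))) (+-shuffle i (m ∸ i) (n ∸ i))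
  where
  +-shuffle : ∀ i x y → (i + x) + (i + y) ≡ i + (i + (x + y))
  +-shuffle = solve-∀

⌈m+n/2⌉∸i≡⌈[m∸i]+[n∸i]/2⌉ : ∀ {i m n} → i ≤ m → i ≤ n → ⌈ m + n /2⌉ ∸ i ≡ ⌈ (m ∸ i) + (n ∸ i) /2⌉
⌈m+n/2⌉∸i≡⌈[m∸i]+[n∸i]/2⌉ {i} i≤m i≤n rewrite m+n≡i+[i+[[m∸i]+[n∸i]]] i≤m i≤n =
  trans (cong (_∸ i) (⌈m+[m+n]/2⌉≡m+⌈n/2⌉ i _)) (m+n∸m≡n i _)

⌊m+n/2⌋∸i≡⌊[m∸i]+[n∸i]/2⌋ : ∀ {i m n} → i ≤ m → i ≤ n → ⌊ m + n /2⌋ ∸ i ≡ ⌊ (m ∸ i) + (n ∸ i) /2⌋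
⌊m+n/2⌋∸i≡⌊[m∸i]+[n∸i]/2⌋ {i} i≤m i≤n rewrite m+n≡i+[i+[[m∸i]+[n∸i]]] i≤m i≤n =
  trans (cong (_∸ i) (⌊m+[m+n]/2⌋≡m+⌊n/2⌋ i _)) (m+n∸m≡n i _)

[m∸i]*[n∸i]≤[⌈m+n/2⌉∸i]*[⌊m+n/2⌋∸i] : ∀ m n i →
  (m ∸ i) * (n ∸ i) ≤ (⌈ m + n /2⌉ ∸ i) * (⌊ m + n /2⌋ ∸ i)
[m∸i]*[n∸i]≤[⌈m+n/2⌉∸i]*[⌊m+n/2⌋∸i] m n i with i ≤? m | i ≤? n
... | no i≰m | _ rewrite m≤n⇒m∸n≡0 (<⇒≤ (≰⇒> i≰m)) = z≤n
... | yes _ | no i≰n rewrite m≤n⇒m∸n≡0 (<⇒≤ (≰⇒> i≰n)) | *-zeroʳ (m ∸ i) = z≤n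
... | yes i≤m | yes i≤n
  rewrite ⌈m+n/2⌉∸i≡⌈[m∸i]+[n∸i]/2⌉ i≤m i≤n | ⌊m+n/2⌋∸i≡⌊[m∸i]+[n∸i]/2⌋ i≤m i≤n =
  *≤⌈m+n/2⌉*⌊m+n/2⌋ (m ∸ i) (n ∸ i)

[⌈m+n/2⌉∸i]+[⌊m+n/2⌋∸i]≡[m∸i]+[n∸i] : ∀ {i m n} → i ≤ m → i ≤ n →
  (⌈ m + n /2⌉ ∸ i) + (⌊ m + n /2⌋ ∸ i) ≡ (m ∸ i) + (n ∸ i)
[⌈m+n/2⌉∸i]+[⌊m+n/2⌋∸i]≡[m∸i]+[n∸i] i≤m i≤n =
  trans (cong₂ _+_ (⌈m+n/2⌉∸i≡⌈[m∸i]+[n∸i]/2⌉ i≤m i≤n) (⌊m+n/2⌋∸i≡⌊[m∸i]+[n∸i]/2⌋ i≤m i≤n)) (⌈n/2⌉+⌊n/2⌋≡n _)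

-- Path numbers of complete bipartite graphs as functions of the class sizes

fallingPairs : ℕ → ℕ → ℕ → ℕ
fallingPairs p q zero    = 1
fallingPairs p q (suc m) = fallingPairs p q m * ((p ∸ m) * (q ∸ m))

fallingPairs-zeroˡ : ∀ {p q m} → p < m → fallingPairs p q m ≡ 0
fallingPairs-zeroˡ {p} {q} {suc m} (s≤s p≤m) rewrite m≤n⇒m∸n≡0 p≤m = *-zeroʳ (fallingPairs p q m)

fallingPairs-zeroʳ : ∀ {p q m} → q < m → fallingPairs p q m ≡ 0
fallingPairs-zeroʳ {p} {q} {suc m} (s≤s q≤m)
  rewrite m≤n⇒m∸n≡0 q≤m | *-zeroʳ (p ∸ m) = *-zeroʳ (fallingPairs p q m)

fallingPairs≤balanced : ∀ p q m → fallingPairs p q m ≤ fallingPairs ⌈ p + q /2⌉ ⌊ p + q /2⌋ m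
fallingPairs≤balanced p q zero    = ≤-refl
fallingPairs≤balanced p q (suc m) =
  *-mono-≤ (fallingPairs≤balanced p q m) ([m∸i]*[n∸i]≤[⌈m+n/2⌉∸i]*[⌊m+n/2⌋∸i] p q m)

fallingPairs*[[p∸m]+[q∸m]]≤balanced : ∀ p q m →
  let a = ⌈ p + q /2⌉ ; b = ⌊ p + q /2⌋ in
  fallingPairs p q m * ((p ∸ m) + (q ∸ m)) ≤ fallingPairs a b m * ((a ∸ m) + (b ∸ m))
fallingPairs*[[p∸m]+[q∸m]]≤balanced p q m with m ≤? p | m ≤? q
... | no m≰p | _ rewrite fallingPairs-zeroˡ {p} {q} (≰⇒> m≰p) = z≤n
... | yes _ | no m≰q rewrite fallingPairs-zeroʳ {p} {q} (≰⇒> m≰q) = z≤n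
... | yes m≤p | yes m≤q = *-mono-≤ (fallingPairs≤balanced p q m)
                            (≤-reflexive (sym ([⌈m+n/2⌉∸i]+[⌊m+n/2⌋∸i]≡[m∸i]+[n∸i] m≤p m≤q)))

-- The number of vertex sequences v₀ … v_k of paths in the complete bipartite graph with colour
-- classes of sizes p (colour true) and q (colour false) and with v₀ of colour b: v₀ is prepended
-- to such a sequence v₁ … v_k starting in the other class, which uses ⌊ suc k /2⌋ vertices of colour b.
bipartitePathsFrom : ℕ → ℕ → Bool → ℕ → ℕ
bipartitePathsFrom p q true  zero    = p
bipartitePathsFrom p q false zero    = q
bipartitePathsFrom p q true  (suc k) = bipartitePathsFrom p q false k * (p ∸ ⌊ suc k /2⌋)
bipartitePathsFrom p q false (suc k) = bipartitePathsFrom p q true k * (q ∸ ⌊ suc k /2⌋)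

bipartitePaths : ℕ → ℕ → ℕ → ℕ
bipartitePaths p q k = bipartitePathsFrom p q true k + bipartitePathsFrom p q false k

bipartitePathsFrom-even : ∀ p q m →
  bipartitePathsFrom p q true (m + m) ≡ fallingPairs p q m * (p ∸ m) ×
  bipartitePathsFrom p q false (m + m) ≡ fallingPairs p q m * (q ∸ m)
bipartitePathsFrom-odd : ∀ p q m b → bipartitePathsFrom p q b (suc (m + m)) ≡ fallingPairs p q (suc m)

bipartitePathsFrom-even p q zero = sym (+-identityʳ p) , sym (+-identityʳ q)
bipartitePathsFrom-even p q (suc m) rewrite +-suc m m | sym (n≡⌊n+n/2⌋ m) =
  cong (_* (p ∸ suc m)) (bipartitePathsFrom-odd p q m false) ,
  cong (_* (q ∸ suc m)) (bipartitePathsFrom-odd p q m true)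

bipartitePathsFrom-odd p q m true rewrite sym (n≡⌈n+n/2⌉ m) = begin
  bipartitePathsFrom p q false (m + m) * (p ∸ m) ≡⟨ cong (_* (p ∸ m)) (proj₂ (bipartitePathsFrom-even p q m)) ⟩
  fallingPairs p q m * (q ∸ m) * (p ∸ m)         ≡⟨ *-assoc (fallingPairs p q m) _ _ ⟩
  fallingPairs p q m * ((q ∸ m) * (p ∸ m))       ≡⟨ cong (fallingPairs p q m *_) (*-comm (q ∸ m) (p ∸ m)) ⟩
  fallingPairs p q (suc m)                       ∎
  where open ≡-Reasoning
bipartitePathsFrom-odd p q m false rewrite sym (n≡⌈n+n/2⌉ m) = begin
  bipartitePathsFrom p q true (m + m) * (q ∸ m) ≡⟨ cong (_* (q ∸ m)) (proj₁ (bipartitePathsFrom-even p q m)) ⟩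
  fallingPairs p q m * (p ∸ m) * (q ∸ m)        ≡⟨ *-assoc (fallingPairs p q m) _ _ ⟩
  fallingPairs p q (suc m)                      ∎
  where open ≡-Reasoning

data Parity : ℕ → Set where
  even : ∀ m → Parity (m + m)
  odd  : ∀ m → Parity (suc (m + m))

parity : ∀ k → Parity k
parity zero = even zero
parity (suc k) with parity k
... | even m = odd m
... | odd m  = subst Parity (cong suc (+-suc m m)) (even (suc m))

bipartitePaths≤balanced : ∀ p q k → bipartitePaths p q k ≤ bipartitePaths ⌈ p + q /2⌉ ⌊ p + q /2⌋ k
bipartitePaths≤balanced p q k with parity k
... | even m = subst₂ _≤_ (sym (total p q)) (sym (total ⌈ p + q /2⌉ ⌊ p + q /2⌋))
                      (fallingPairs*[[p∸m]+[q∸m]]≤balanced p q m)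
  where
  total : ∀ p q → bipartitePaths p q (m + m) ≡ fallingPairs p q m * ((p ∸ m) + (q ∸ m))
  total p q = trans (cong₂ _+_ (proj₁ (bipartitePathsFrom-even p q m)) (proj₂ (bipartitePathsFrom-even p q m)))
                    (sym (*-distribˡ-+ (fallingPairs p q m) _ _))
... | odd m
  rewrite bipartitePathsFrom-odd p q m true | bipartitePathsFrom-odd p q m false
        | bipartitePathsFrom-odd ⌈ p + q /2⌉ ⌊ p + q /2⌋ m true
        | bipartitePathsFrom-odd ⌈ p + q /2⌉ ⌊ p + q /2⌋ m false =
  +-mono-≤ (fallingPairs≤balanced p q (suc m)) (fallingPairs≤balanced p q (suc m))

-- Counting

𝟙 : Bool → ℕ
𝟙 true  = 1
𝟙 false = 0

sumBy : {A : Set} → (A → ℕ) → List A → ℕ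
sumBy f []       = 0
sumBy f (x ∷ xs) = f x + sumBy f xs

count : {A : Set} → (A → Bool) → List A → ℕ
count P = sumBy (λ x → 𝟙 (P x))

module _ {A : Set} where

  sumBy-cong : {f g : A → ℕ} (xs : List A) → (∀ x → f x ≡ g x) → sumBy f xs ≡ sumBy g xs
  sumBy-cong []       f≗g = refl
  sumBy-cong (x ∷ xs) f≗g = cong₂ _+_ (f≗g x) (sumBy-cong xs f≗g)

  sumBy-mono : {f g : A → ℕ} (xs : List A) → (∀ x → f x ≤ g x) → sumBy f xs ≤ sumBy g xs
  sumBy-mono []       f≤g = z≤n
  sumBy-mono (x ∷ xs) f≤g = +-mono-≤ (f≤g x) (sumBy-mono xs f≤g)

  sumBy-0 : (xs : List A) → sumBy (λ _ → 0) xs ≡ 0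
  sumBy-0 []       = refl
  sumBy-0 (_ ∷ xs) = sumBy-0 xs

  sumBy-+ : (f g : A → ℕ) (xs : List A) → sumBy (λ x → f x + g x) xs ≡ sumBy f xs + sumBy g xs
  sumBy-+ f g []       = refl
  sumBy-+ f g (x ∷ xs) rewrite sumBy-+ f g xs = +-interchange (f x) (g x) (sumBy f xs) (sumBy g xs)
    where
    +-interchange : ∀ a b c d → a + b + (c + d) ≡ a + c + (b + d)
    +-interchange = solve-∀

  sumBy-*ˡ : (k : ℕ) (f : A → ℕ) (xs : List A) → sumBy (λ x → k * f x) xs ≡ k * sumBy f xs
  sumBy-*ˡ k f []       = sym (*-zeroʳ k)
  sumBy-*ˡ k f (x ∷ xs) = trans (cong (k * f x +_) (sumBy-*ˡ k f xs)) (sym (*-distribˡ-+ k (f x) _))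

  sumBy-*ʳ : (k : ℕ) (f : A → ℕ) (xs : List A) → sumBy (λ x → f x * k) xs ≡ sumBy f xs * k
  sumBy-*ʳ k f xs = trans (sumBy-cong xs (λ x → *-comm (f x) k)) (trans (sumBy-*ˡ k f xs) (*-comm k _))

  sumBy-++ : (f : A → ℕ) (xs ys : List A) → sumBy f (xs ++ ys) ≡ sumBy f xs + sumBy f ys
  sumBy-++ f []       ys = refl
  sumBy-++ f (x ∷ xs) ys = trans (cong (f x +_) (sumBy-++ f xs ys)) (sym (+-assoc (f x) _ _))

  length-filter≡count : (P : A → Bool) (xs : List A) → length (filter (λ x → P x ≟ᵇ true) xs) ≡ count P xs
  length-filter≡count P [] = refl
  length-filter≡count P (x ∷ xs) with P x
  ... | true  = cong suc (length-filter≡count P xs)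
  ... | false = length-filter≡count P xs

  count+count-not≡length : (P : A → Bool) (xs : List A) → count P xs + count (λ x → not (P x)) xs ≡ length xs
  count+count-not≡length P [] = refl
  count+count-not≡length P (x ∷ xs) with P x
  ... | true  = cong suc (count+count-not≡length P xs)
  ... | false = trans (+-suc _ _) (cong suc (count+count-not≡length P xs))

module _ {A B : Set} where

  sumBy-map : (f : B → ℕ) (g : A → B) (xs : List A) → sumBy f (map g xs) ≡ sumBy (λ x → f (g x)) xs
  sumBy-map f g []       = refl
  sumBy-map f g (x ∷ xs) = cong (f (g x) +_) (sumBy-map f g xs)

  sumBy-concatMap : (f : B → ℕ) (g : A → List B) (xs : List A) →
    sumBy f (concatMap g xs) ≡ sumBy (λ x → sumBy f (g x)) xs
  sumBy-concatMap f g []       = refl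
  sumBy-concatMap f g (x ∷ xs) =
    trans (sumBy-++ f (g x) (concatMap g xs)) (cong (sumBy f (g x) +_) (sumBy-concatMap f g xs))

  sumBy-swap : (h : A → B → ℕ) (xs : List A) (ys : List B) →
    sumBy (λ x → sumBy (h x) ys) xs ≡ sumBy (λ y → sumBy (λ x → h x y) xs) ys
  sumBy-swap h []       ys = sym (sumBy-0 ys)
  sumBy-swap h (x ∷ xs) ys =
    trans (cong (sumBy (h x) ys +_) (sumBy-swap h xs ys)) (sym (sumBy-+ _ _ ys))

+-≤-≡⇒≡ : ∀ {a b c d} → a ≤ c → b ≤ d → a + b ≡ c + d → a ≡ c
+-≤-≡⇒≡ a≤c b≤d eq with m≤n⇒m<n∨m≡n a≤c
... | inj₂ a≡c = a≡c
... | inj₁ a<c = ⊥-elim (<-irrefl eq (+-mono-<-≤ a<c b≤d))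

sum-applyUpTo-cong : ∀ n {f g : ℕ → ℕ} → (∀ k → f k ≡ g k) → sum (applyUpTo f n) ≡ sum (applyUpTo g n)
sum-applyUpTo-cong zero    f≗g = refl
sum-applyUpTo-cong (suc n) f≗g = cong₂ _+_ (f≗g 0) (sum-applyUpTo-cong n (λ k → f≗g (suc k)))

sum-applyUpTo-mono : ∀ n {f g : ℕ → ℕ} → (∀ k → f k ≤ g k) → sum (applyUpTo f n) ≤ sum (applyUpTo g n)
sum-applyUpTo-mono zero    f≤g = z≤n
sum-applyUpTo-mono (suc n) f≤g = +-mono-≤ (f≤g 0) (sum-applyUpTo-mono n (λ k → f≤g (suc k)))

sum-applyUpTo-≡⇒≡ : ∀ n {f g : ℕ → ℕ} → (∀ k → f k ≤ g k) →
  sum (applyUpTo f n) ≡ sum (applyUpTo g n) → ∀ k → k < n → f k ≡ g k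
sum-applyUpTo-≡⇒≡ (suc n) {f} {g} f≤g eq k k<1+n
  with +-≤-≡⇒≡ (f≤g 0) (sum-applyUpTo-mono n (λ k → f≤g (suc k))) eq
sum-applyUpTo-≡⇒≡ (suc n) {f} {g} f≤g eq zero    _         | f0≡g0 = f0≡g0
sum-applyUpTo-≡⇒≡ (suc n) {f} {g} f≤g eq (suc k) (s≤s k<n) | f0≡g0 =
  sum-applyUpTo-≡⇒≡ n (λ k → f≤g (suc k)) (+-cancelˡ-≡ (f 0) _ _ (trans eq (cong (_+ _) (sym f0≡g0)))) k k<n

𝟙-∧ : ∀ a b → 𝟙 (a ∧ b) ≡ 𝟙 a * 𝟙 b
𝟙-∧ true  b = sym (+-identityʳ (𝟙 b))
𝟙-∧ false b = refl

𝟙-mono : ∀ {a b} → (a ≡ true → b ≡ true) → 𝟙 a ≤ 𝟙 b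
𝟙-mono {false} _    = z≤n
𝟙-mono {true}  a⇒b rewrite a⇒b refl = ≤-refl

∧-true : ∀ {a b} → a ∧ b ≡ true → a ≡ true × b ≡ true
∧-true {true} {true} _ = refl , refl

xor≡true : ∀ {a b} → a ≢ b → a xor b ≡ true
xor≡true {true}  {true}  a≢b = ⊥-elim (a≢b refl)
xor≡true {true}  {false} _   = refl
xor≡true {false} {true}  _   = refl
xor≡true {false} {false} a≢b = ⊥-elim (a≢b refl)

not-xor-not : ∀ a b → not a xor not b ≡ a xor b
not-xor-not a b = trans (sym (not-distribˡ-xor a (not b)))
                        (trans (cong not (sym (not-distribʳ-xor a b))) (not-involutive (a xor b)))

<⇒<ᵇ≡true : ∀ {m n} → m < n → (m <ᵇ n) ≡ true
<⇒<ᵇ≡true m<n = Equivalence.to T-≡ (<⇒<ᵇ m<n)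

<ᵇ≡true⇒< : ∀ {m n} → (m <ᵇ n) ≡ true → m < n
<ᵇ≡true⇒< {m} {n} m<ᵇn = <ᵇ⇒< m n (Equivalence.from T-≡ m<ᵇn)

≮⇒<ᵇ≡false : ∀ {m n} → ¬ m < n → (m <ᵇ n) ≡ false
≮⇒<ᵇ≡false {m} {n} m≮n with m <ᵇ n in m<ᵇn
... | false = refl
... | true  = ⊥-elim (m≮n (<ᵇ≡true⇒< m<ᵇn))

sumBy-allFin-suc : (n : ℕ) (f : Fin (suc n) → ℕ) →
  sumBy f (allFin (suc n)) ≡ f fzero + sumBy (λ x → f (fsuc x)) (allFin n)
sumBy-allFin-suc n f =
  trans (cong (λ xs → f fzero + sumBy f xs) (sym (map-tabulate (λ x → x) fsuc)))
        (cong (f fzero +_) (sumBy-map f fsuc (allFin n)))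

count-allFin-true : (n : ℕ) → count (λ (_ : Fin n) → true) (allFin n) ≡ n
count-allFin-true zero    = refl
count-allFin-true (suc n) = trans (sumBy-allFin-suc n (λ _ → 1)) (cong suc (count-allFin-true n))

count-allFin-<ᵇ : ∀ n a → a ≤ n → count (λ (u : Fin n) → toℕ u <ᵇ a) (allFin n) ≡ a
count-allFin-<ᵇ zero    zero    _ = refl
count-allFin-<ᵇ (suc n) zero    _ = trans (sumBy-allFin-suc n (λ u → 𝟙 (toℕ u <ᵇ 0))) (sumBy-0 (allFin n))
count-allFin-<ᵇ (suc n) (suc a) (s≤s a≤n) =
  trans (sumBy-allFin-suc n (λ u → 𝟙 (toℕ u <ᵇ suc a))) (cong suc (count-allFin-<ᵇ n a a≤n))

count+count-not≡n : {n : ℕ} (P : Fin n → Bool) → count P (allFin n) + count (λ x → not (P x)) (allFin n) ≡ n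
count+count-not≡n {n} P = trans (count+count-not≡length P (allFin n)) (length-tabulate (λ x → x))

⌊fsuc≟fsuc⌋ : {n : ℕ} (x y : Fin n) → ⌊ fsuc x ≟ fsuc y ⌋ ≡ ⌊ x ≟ y ⌋
⌊fsuc≟fsuc⌋ x y with x ≟ y
... | yes _ = refl
... | no  _ = refl

⌊≟⌋-refl : {n : ℕ} (x : Fin n) → ⌊ x ≟ x ⌋ ≡ true
⌊≟⌋-refl x with x ≟ x
... | yes _   = refl
... | no  x≢x = ⊥-elim (x≢x refl)

⌊≟⌋⇒≡ : {n : ℕ} {x y : Fin n} → ⌊ x ≟ y ⌋ ≡ true → x ≡ y
⌊≟⌋⇒≡ {x = x} {y} _ with x ≟ y
... | yes x≡y = x≡y

count-allFin-remove : {n : ℕ} (P : Fin n → Bool) (y : Fin n) →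
  count (λ x → P x ∧ not ⌊ x ≟ y ⌋) (allFin n) + 𝟙 (P y) ≡ count P (allFin n)
count-allFin-remove {suc n} P fzero = begin
  count (λ x → P x ∧ not ⌊ x ≟ fzero ⌋) (allFin (suc n)) + 𝟙 (P fzero)
    ≡⟨ cong (_+ 𝟙 (P fzero)) (sumBy-allFin-suc n (λ x → 𝟙 (P x ∧ not ⌊ x ≟ fzero ⌋))) ⟩
  𝟙 (P fzero ∧ false) + count (λ x → P (fsuc x) ∧ true) (allFin n) + 𝟙 (P fzero)
    ≡⟨ cong₂ (λ u v → u + v + 𝟙 (P fzero)) (cong 𝟙 (∧-zeroʳ (P fzero)))
             (sumBy-cong (allFin n) (λ x → cong 𝟙 (∧-identityʳ (P (fsuc x))))) ⟩
  count (λ x → P (fsuc x)) (allFin n) + 𝟙 (P fzero)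
    ≡⟨ +-comm _ (𝟙 (P fzero)) ⟩
  𝟙 (P fzero) + count (λ x → P (fsuc x)) (allFin n)
    ≡⟨ sumBy-allFin-suc n (λ x → 𝟙 (P x)) ⟨
  count P (allFin (suc n)) ∎
  where open ≡-Reasoning
count-allFin-remove {suc n} P (fsuc y) = begin
  count (λ x → P x ∧ not ⌊ x ≟ fsuc y ⌋) (allFin (suc n)) + 𝟙 (P (fsuc y))
    ≡⟨ cong (_+ 𝟙 (P (fsuc y))) (sumBy-allFin-suc n (λ x → 𝟙 (P x ∧ not ⌊ x ≟ fsuc y ⌋))) ⟩
  𝟙 (P fzero ∧ true) + count (λ x → P (fsuc x) ∧ not ⌊ fsuc x ≟ fsuc y ⌋) (allFin n) + 𝟙 (P (fsuc y))
    ≡⟨ cong (λ k → 𝟙 (P fzero ∧ true) + k + 𝟙 (P (fsuc y)))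
            (sumBy-cong (allFin n) (λ x → cong (λ b → 𝟙 (P (fsuc x) ∧ not b)) (⌊fsuc≟fsuc⌋ x y))) ⟩
  𝟙 (P fzero ∧ true) + count (λ x → P (fsuc x) ∧ not ⌊ x ≟ y ⌋) (allFin n) + 𝟙 (P (fsuc y))
    ≡⟨ +-assoc (𝟙 (P fzero ∧ true)) _ _ ⟩
  𝟙 (P fzero ∧ true) + (count (λ x → P (fsuc x) ∧ not ⌊ x ≟ y ⌋) (allFin n) + 𝟙 (P (fsuc y)))
    ≡⟨ cong₂ _+_ (cong 𝟙 (∧-identityʳ (P fzero))) (count-allFin-remove (λ x → P (fsuc x)) y) ⟩
  𝟙 (P fzero) + count (λ x → P (fsuc x)) (allFin n)
    ≡⟨ sumBy-allFin-suc n (λ x → 𝟙 (P x)) ⟨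
  count P (allFin (suc n)) ∎
  where open ≡-Reasoning

count-allFin-≟ : {n : ℕ} (y : Fin n) → count (λ x → ⌊ x ≟ y ⌋) (allFin n) ≡ 1
count-allFin-≟ {n} y = begin
  count (λ x → ⌊ x ≟ y ⌋) (allFin n)
    ≡⟨ count-allFin-remove (λ x → ⌊ x ≟ y ⌋) y ⟨
  count (λ x → ⌊ x ≟ y ⌋ ∧ not ⌊ x ≟ y ⌋) (allFin n) + 𝟙 ⌊ y ≟ y ⌋
    ≡⟨ cong₂ _+_ (sumBy-cong (allFin n) (λ x → cong 𝟙 (∧-not ⌊ x ≟ y ⌋))) (cong 𝟙 (⌊≟⌋-refl y)) ⟩
  sumBy (λ _ → 0) (allFin n) + 1
    ≡⟨ cong (_+ 1) (sumBy-0 (allFin n)) ⟩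
  1 ∎
  where
  open ≡-Reasoning
  ∧-not : ∀ b → b ∧ not b ≡ false
  ∧-not true  = refl
  ∧-not false = refl

count-allFin-∖ : {n : ℕ} (P : Fin n → Bool) (xs : List (Fin n)) → distinct xs ≡ true →
  count (λ x → P x ∧ not (elem x xs)) (allFin n) + count P xs ≡ count P (allFin n)
count-allFin-∖ {n} P [] _ =
  trans (+-identityʳ _) (sumBy-cong (allFin n) (λ x → cong 𝟙 (∧-identityʳ (P x))))
count-allFin-∖ {n} P (y ∷ ys) distinct-y∷ys with elem y ys in y∉ys
... | false = begin
  count (λ x → P x ∧ not (⌊ x ≟ y ⌋ ∨ elem x ys)) (allFin n) + (𝟙 (P y) + count P ys)
    ≡⟨ cong₂ _+_ (sumBy-cong (allFin n) (λ x → cong 𝟙 (reorder (P x) ⌊ x ≟ y ⌋ (elem x ys))))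
                 (trans (cong (λ b → 𝟙 (P y ∧ not b) + count P ys) y∉ys)
                        (cong (λ b → 𝟙 b + count P ys) (∧-identityʳ (P y)))) ⟨
  count (λ x → P′ x ∧ not ⌊ x ≟ y ⌋) (allFin n) + (𝟙 (P′ y) + count P ys)
    ≡⟨ +-assoc (count (λ x → P′ x ∧ not ⌊ x ≟ y ⌋) (allFin n)) (𝟙 (P′ y)) (count P ys) ⟨
  count (λ x → P′ x ∧ not ⌊ x ≟ y ⌋) (allFin n) + 𝟙 (P′ y) + count P ys
    ≡⟨ cong (_+ count P ys) (count-allFin-remove P′ y) ⟩
  count P′ (allFin n) + count P ys
    ≡⟨ count-allFin-∖ P ys distinct-y∷ys ⟩
  count P (allFin n) ∎
  where
  open ≡-Reasoning
  P′ : Fin n → Bool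
  P′ x = P x ∧ not (elem x ys)
  reorder : ∀ a b c → (a ∧ not c) ∧ not b ≡ a ∧ not (b ∨ c)
  reorder true  true  c     = ∧-zeroʳ (not c)
  reorder true  false c     = ∧-identityʳ (not c)
  reorder false b     c     = refl

count-allFin-< : {n : ℕ} {P Q : Fin n → Bool} (u : Fin n) → (∀ w → P w ≡ true → Q w ≡ true) →
  P u ≡ false → Q u ≡ true → count P (allFin n) < count Q (allFin n)
count-allFin-< {n} {P} {Q} u P⇒Q Pu≡false Qu≡true = begin-strict
  count P (allFin n)                      ≡⟨ count-allFin-remove P u ⟨
  count P∖u (allFin n) + 𝟙 (P u)          ≡⟨ cong (λ b → count P∖u (allFin n) + 𝟙 b) Pu≡false ⟩
  count P∖u (allFin n) + 0                <⟨ +-mono-≤-< P∖u≤Q∖u (s≤s z≤n) ⟩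
  count Q∖u (allFin n) + 1                ≡⟨ cong (λ b → count Q∖u (allFin n) + 𝟙 b) Qu≡true ⟨
  count Q∖u (allFin n) + 𝟙 (Q u)          ≡⟨ count-allFin-remove Q u ⟩
  count Q (allFin n)                      ∎
  where
  open ≤-Reasoning
  P∖u Q∖u : Fin n → Bool
  P∖u x = P x ∧ not ⌊ x ≟ u ⌋
  Q∖u x = Q x ∧ not ⌊ x ≟ u ⌋
  P∖u⇒Q∖u : ∀ w → P∖u w ≡ true → Q∖u w ≡ true
  P∖u⇒Q∖u w P∖uw with ∧-true {P w} P∖uw
  ... | Pw , w≢u = cong₂ _∧_ (P⇒Q w Pw) w≢u
  P∖u≤Q∖u : count P∖u (allFin n) ≤ count Q∖u (allFin n)
  P∖u≤Q∖u = sumBy-mono (allFin n) (λ w → 𝟙-mono (P∖u⇒Q∖u w))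

module _ {n : ℕ} where

  sumBy-listsOfLength-suc : (f : List (Fin n) → ℕ) (L : ℕ) →
    sumBy f (listsOfLength (suc L)) ≡ sumBy (λ xs → sumBy (λ x → f (x ∷ xs)) (allFin n)) (listsOfLength L)
  sumBy-listsOfLength-suc f L =
    trans (sumBy-concatMap f (λ xs → map (_∷ xs) (allFin n)) (listsOfLength L))
          (sumBy-cong (listsOfLength L) (λ xs → sumBy-map f (_∷ xs) (allFin n)))

  sumBy-listsOfLength-1 : (f : List (Fin n) → ℕ) → sumBy f (listsOfLength 1) ≡ sumBy (λ x → f (x ∷ [])) (allFin n)
  sumBy-listsOfLength-1 f = trans (sumBy-listsOfLength-suc f 0) (+-identityʳ _)

  sumBy-listsOfLength-cong : {f g : List (Fin n) → ℕ} (L : ℕ) → (∀ xs → length xs ≡ L → f xs ≡ g xs) →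
    sumBy f (listsOfLength L) ≡ sumBy g (listsOfLength L)
  sumBy-listsOfLength-cong zero    f≗g = cong (_+ 0) (f≗g [] refl)
  sumBy-listsOfLength-cong {f} {g} (suc L) f≗g = begin
    sumBy f (listsOfLength (suc L))                                        ≡⟨ sumBy-listsOfLength-suc f L ⟩
    sumBy (λ xs → sumBy (λ x → f (x ∷ xs)) (allFin n)) (listsOfLength L)
      ≡⟨ sumBy-listsOfLength-cong L (λ xs ∣xs∣≡L → sumBy-cong (allFin n) (λ x → f≗g (x ∷ xs) (cong suc ∣xs∣≡L)))
       ⟩
    sumBy (λ xs → sumBy (λ x → g (x ∷ xs)) (allFin n)) (listsOfLength L)  ≡⟨ sumBy-listsOfLength-suc g L ⟨
    sumBy g (listsOfLength (suc L))                                        ∎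
    where open ≡-Reasoning

  sumBy-listsOfLength-mono : {f g : List (Fin n) → ℕ} (L : ℕ) → (∀ xs → length xs ≡ L → f xs ≤ g xs) →
    sumBy f (listsOfLength L) ≤ sumBy g (listsOfLength L)
  sumBy-listsOfLength-mono zero    f≤g = +-monoˡ-≤ 0 (f≤g [] refl)
  sumBy-listsOfLength-mono {f} {g} (suc L) f≤g =
    subst₂ _≤_ (sym (sumBy-listsOfLength-suc f L)) (sym (sumBy-listsOfLength-suc g L))
      (sumBy-listsOfLength-mono L (λ xs ∣xs∣≡L → sumBy-mono (allFin n) (λ x → f≤g (x ∷ xs) (cong suc ∣xs∣≡L))))

  infix 4 _==_

  _==_ : List (Fin n) → List (Fin n) → Bool
  []       == []       = true
  (x ∷ xs) == (y ∷ ys) = ⌊ x ≟ y ⌋ ∧ (xs == ys)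
  _        == _        = false

  ==-refl : (xs : List (Fin n)) → (xs == xs) ≡ true
  ==-refl []       = refl
  ==-refl (x ∷ xs) rewrite ⌊≟⌋-refl x = ==-refl xs

  ==⇒≡ : (xs ys : List (Fin n)) → (xs == ys) ≡ true → xs ≡ ys
  ==⇒≡ []       []       _  = refl
  ==⇒≡ (x ∷ xs) (y ∷ ys) eq with ∧-true {⌊ x ≟ y ⌋} eq
  ... | x≡y , xs≡ys = cong₂ _∷_ (⌊≟⌋⇒≡ x≡y) (==⇒≡ xs ys xs≡ys)

  count-listsOfLength-== : (L : ℕ) (ys : List (Fin n)) → length ys ≡ L →
    count (_== ys) (listsOfLength L) ≡ 1
  count-listsOfLength-== zero    []       _       = refl
  count-listsOfLength-== (suc L) (y ∷ ys) ∣y∷ys∣≡1+L = begin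
    count (_== y ∷ ys) (listsOfLength (suc L))
      ≡⟨ sumBy-listsOfLength-suc _ L ⟩
    sumBy (λ zs → sumBy (λ x → 𝟙 (⌊ x ≟ y ⌋ ∧ (zs == ys))) (allFin n)) (listsOfLength L)
      ≡⟨ sumBy-cong (listsOfLength L) (λ zs → factor zs) ⟩
    sumBy (λ zs → count (λ x → ⌊ x ≟ y ⌋) (allFin n) * 𝟙 (zs == ys)) (listsOfLength L)
      ≡⟨ sumBy-cong (listsOfLength L) (λ zs → cong (_* 𝟙 (zs == ys)) (count-allFin-≟ y)) ⟩
    sumBy (λ zs → 1 * 𝟙 (zs == ys)) (listsOfLength L)
      ≡⟨ sumBy-cong (listsOfLength L) (λ zs → +-identityʳ _) ⟩
    count (_== ys) (listsOfLength L)
      ≡⟨ count-listsOfLength-== L ys (suc-injective ∣y∷ys∣≡1+L) ⟩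
    1 ∎
    where
    open ≡-Reasoning
    factor : ∀ zs → sumBy (λ x → 𝟙 (⌊ x ≟ y ⌋ ∧ (zs == ys))) (allFin n) ≡
                    count (λ x → ⌊ x ≟ y ⌋) (allFin n) * 𝟙 (zs == ys)
    factor zs = trans (sumBy-cong (allFin n) (λ x → 𝟙-∧ ⌊ x ≟ y ⌋ (zs == ys)))
                      (sumBy-*ʳ (𝟙 (zs == ys)) (λ x → 𝟙 ⌊ x ≟ y ⌋) (allFin n))

  -- Double counting against the indicator of xs == φ ys, each row and column of which sums to 1.
  sumBy-listsOfLength-involution : (φ : List (Fin n) → List (Fin n)) → (∀ xs → φ (φ xs) ≡ xs) →
    (∀ xs → length (φ xs) ≡ length xs) → (f : List (Fin n) → ℕ) (L : ℕ) →
    sumBy f (listsOfLength L) ≡ sumBy (λ xs → f (φ xs)) (listsOfLength L)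
  sumBy-listsOfLength-involution φ φ∘φ≗id ∣φ∣≗∣∣ f L = begin
    sumBy f Ls
      ≡⟨ sumBy-listsOfLength-cong L (λ ys ∣ys∣≡L → sym (*1 (f ys) (φ ys) (trans (∣φ∣≗∣∣ ys) ∣ys∣≡L))) ⟩
    sumBy (λ ys → f ys * count (_== φ ys) Ls) Ls
      ≡⟨ sumBy-cong Ls (λ ys → sumBy-*ˡ (f ys) (λ xs → 𝟙 (xs == φ ys)) Ls) ⟨
    sumBy (λ ys → sumBy (λ xs → f ys * 𝟙 (xs == φ ys)) Ls) Ls
      ≡⟨ sumBy-swap (λ ys xs → f ys * 𝟙 (xs == φ ys)) Ls Ls ⟩
    sumBy (λ xs → sumBy (λ ys → f ys * 𝟙 (xs == φ ys)) Ls) Ls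
      ≡⟨ sumBy-cong Ls (λ xs → sumBy-cong Ls (λ ys → transpose xs ys)) ⟩
    sumBy (λ xs → sumBy (λ ys → f (φ xs) * 𝟙 (ys == φ xs)) Ls) Ls
      ≡⟨ sumBy-cong Ls (λ xs → sumBy-*ˡ (f (φ xs)) (λ ys → 𝟙 (ys == φ xs)) Ls) ⟩
    sumBy (λ xs → f (φ xs) * count (_== φ xs) Ls) Ls
      ≡⟨ sumBy-listsOfLength-cong L (λ xs ∣xs∣≡L → *1 (f (φ xs)) (φ xs) (trans (∣φ∣≗∣∣ xs) ∣xs∣≡L)) ⟩
    sumBy (λ xs → f (φ xs)) Ls ∎
    where
    open ≡-Reasoning
    Ls = listsOfLength L
    *1 : ∀ k ys → length ys ≡ L → k * count (_== ys) Ls ≡ k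
    *1 k ys ∣ys∣≡L = trans (cong (k *_) (count-listsOfLength-== L ys ∣ys∣≡L)) (*-identityʳ k)
    xs=φys⇒ys=φxs : ∀ {xs ys} → (xs == φ ys) ≡ true → (ys == φ xs) ≡ true
    xs=φys⇒ys=φxs {xs} {ys} xs=φys rewrite ==⇒≡ xs (φ ys) xs=φys | φ∘φ≗id ys = ==-refl ys
    transpose : ∀ xs ys → f ys * 𝟙 (xs == φ ys) ≡ f (φ xs) * 𝟙 (ys == φ xs)
    transpose xs ys with xs == φ ys in xs=φys | ys == φ xs in ys=φxs
    ... | false | false = trans (*-zeroʳ (f ys)) (sym (*-zeroʳ (f (φ xs))))
    ... | true  | true  rewrite ==⇒≡ ys (φ xs) ys=φxs = refl
    ... | true  | false = case trans (sym (xs=φys⇒ys=φxs {xs} {ys} xs=φys)) ys=φxs of λ ()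
    ... | false | true  = case trans (sym (xs=φys⇒ys=φxs {ys} {xs} ys=φxs)) xs=φys of λ ()

  sumBy-listsOfLength-< : {f g : List (Fin n) → ℕ} (L : ℕ) (ys : List (Fin n)) →
    (∀ xs → length xs ≡ L → f xs ≤ g xs) → length ys ≡ L → f ys < g ys →
    sumBy f (listsOfLength L) < sumBy g (listsOfLength L)
  sumBy-listsOfLength-< {f} {g} L ys f≤g ∣ys∣≡L fys<gys =
    subst (_≤ sumBy g (listsOfLength L)) f+[ys]≡1+f (sumBy-listsOfLength-mono L f+[ys]≤g)
    where
    f+[ys]≡1+f : sumBy (λ xs → f xs + 𝟙 (xs == ys)) (listsOfLength L) ≡ suc (sumBy f (listsOfLength L))
    f+[ys]≡1+f = trans (sumBy-+ f _ (listsOfLength L))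
                       (trans (cong (sumBy f (listsOfLength L) +_) (count-listsOfLength-== L ys ∣ys∣≡L))
                              (+-comm _ 1))
    f+[ys]≤g : ∀ xs → length xs ≡ L → f xs + 𝟙 (xs == ys) ≤ g xs
    f+[ys]≤g xs ∣xs∣≡L with xs == ys in xs=ys
    ... | false = subst (_≤ g xs) (sym (+-identityʳ (f xs))) (f≤g xs ∣xs∣≡L)
    ... | true rewrite ==⇒≡ xs ys xs=ys = subst (_≤ g ys) (+-comm 1 (f ys)) fys<gys

-- Paths as vertex sequences

module _ {n : ℕ} where

  isOrderedPath : Graph n → List (Fin n) → Bool
  isOrderedPath G xs = distinct xs ∧ walkB G xs

  paths : Graph n → ℕ → ℕ
  paths G k = count (isCanonPath G) (listsOfLength (suc k))

  orderedPaths : Graph n → ℕ → ℕ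
  orderedPaths G k = count (isOrderedPath G) (listsOfLength (suc k))

  elem-∷ʳ : (x : Fin n) (ys : List (Fin n)) (z : Fin n) → elem x (ys ∷ʳ z) ≡ elem x ys ∨ ⌊ x ≟ z ⌋
  elem-∷ʳ x []       z = ∨-identityʳ ⌊ x ≟ z ⌋
  elem-∷ʳ x (y ∷ ys) z = trans (cong (⌊ x ≟ y ⌋ ∨_) (elem-∷ʳ x ys z)) (sym (∨-assoc ⌊ x ≟ y ⌋ _ _))

  elem-reverse : (x : Fin n) (ys : List (Fin n)) → elem x (reverse ys) ≡ elem x ys
  elem-reverse x []       = refl
  elem-reverse x (y ∷ ys) rewrite unfold-reverse y ys =
    trans (elem-∷ʳ x (reverse ys) y) (trans (cong (_∨ ⌊ x ≟ y ⌋) (elem-reverse x ys)) (∨-comm (elem x ys) _))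

  ⌊≟⌋-sym : (x y : Fin n) → ⌊ x ≟ y ⌋ ≡ ⌊ y ≟ x ⌋
  ⌊≟⌋-sym x y with x ≟ y | y ≟ x
  ... | yes _   | yes _   = refl
  ... | no  _   | no  _   = refl
  ... | yes x≡y | no  y≢x = ⊥-elim (y≢x (sym x≡y))
  ... | no  x≢y | yes y≡x = ⊥-elim (x≢y (sym y≡x))

  distinct-∷ʳ : (ys : List (Fin n)) (z : Fin n) → distinct (ys ∷ʳ z) ≡ not (elem z ys) ∧ distinct ys
  distinct-∷ʳ []       z = refl
  distinct-∷ʳ (y ∷ ys) z rewrite elem-∷ʳ y ys z | distinct-∷ʳ ys z | ⌊≟⌋-sym y z =
    shuffle (elem y ys) ⌊ z ≟ y ⌋ (elem z ys) (distinct ys)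
    where
    shuffle : ∀ a b c d → not (a ∨ b) ∧ (not c ∧ d) ≡ not (b ∨ c) ∧ (not a ∧ d)
    shuffle true  true  c     d = refl
    shuffle true  false true  d = refl
    shuffle true  false false d = refl
    shuffle false true  c     d = refl
    shuffle false false true  d = refl
    shuffle false false false d = refl

  distinct-reverse : (xs : List (Fin n)) → distinct (reverse xs) ≡ distinct xs
  distinct-reverse []       = refl
  distinct-reverse (x ∷ xs) rewrite unfold-reverse x xs | distinct-∷ʳ (reverse xs) x
                                  | elem-reverse x xs | distinct-reverse xs = refl

  walkB-∷ʳ-∷ʳ : (G : Graph n) (ys : List (Fin n)) (a b : Fin n) →
    walkB G (ys ∷ʳ a ∷ʳ b) ≡ walkB G (ys ∷ʳ a) ∧ adj G a b
  walkB-∷ʳ-∷ʳ G []           a b = ∧-identityʳ (adj G a b)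
  walkB-∷ʳ-∷ʳ G (y ∷ [])     a b rewrite ∧-identityʳ (adj G a b) =
    sym (cong (_∧ adj G a b) (∧-identityʳ (adj G y a)))
  walkB-∷ʳ-∷ʳ G (y ∷ y′ ∷ ys) a b =
    trans (cong (adj G y y′ ∧_) (walkB-∷ʳ-∷ʳ G (y′ ∷ ys) a b)) (sym (∧-assoc (adj G y y′) _ _))

  walkB-reverse : (G : Graph n) (xs : List (Fin n)) → walkB G (reverse xs) ≡ walkB G xs
  walkB-reverse G []           = refl
  walkB-reverse G (x ∷ [])     = refl
  walkB-reverse G (x ∷ y ∷ ys) = begin
    walkB G (reverse (x ∷ y ∷ ys))          ≡⟨ cong (walkB G) (unfold-reverse x (y ∷ ys)) ⟩
    walkB G (reverse (y ∷ ys) ∷ʳ x)         ≡⟨ cong (λ l → walkB G (l ∷ʳ x)) (unfold-reverse y ys) ⟩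
    walkB G (reverse ys ∷ʳ y ∷ʳ x)          ≡⟨ walkB-∷ʳ-∷ʳ G (reverse ys) y x ⟩
    walkB G (reverse ys ∷ʳ y) ∧ adj G y x   ≡⟨ cong (λ l → walkB G l ∧ adj G y x) (unfold-reverse y ys) ⟨
    walkB G (reverse (y ∷ ys)) ∧ adj G y x  ≡⟨ cong₂ _∧_ (walkB-reverse G (y ∷ ys)) (Graph.sym G y x) ⟩
    walkB G (y ∷ ys) ∧ adj G x y            ≡⟨ ∧-comm (walkB G (y ∷ ys)) (adj G x y) ⟩
    walkB G (x ∷ y ∷ ys)                    ∎
    where open ≡-Reasoning

  reverse-∷ : (y : Fin n) (ys : List (Fin n)) → Σ[ w ∈ List (Fin n) ] reverse (y ∷ ys) ≡ lastOr y ys ∷ w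
  reverse-∷ y []        = [] , refl
  reverse-∷ y (y′ ∷ ys) with reverse-∷ y′ ys
  ... | w , eq = w ∷ʳ y , trans (unfold-reverse y (y′ ∷ ys)) (cong (_∷ʳ y) eq)

  lastOr-∷ʳ : (d : Fin n) (w : List (Fin n)) (x : Fin n) → lastOr d (w ∷ʳ x) ≡ x
  lastOr-∷ʳ d []      x = refl
  lastOr-∷ʳ d (y ∷ w) x = lastOr-∷ʳ y w x

  canonical-reverse : (x y : Fin n) (ys : List (Fin n)) →
    canonical (reverse (x ∷ y ∷ ys)) ≡ (toℕ (lastOr y ys) <ᵇ toℕ x)
  canonical-reverse x y ys with reverse-∷ y ys
  ... | []    , eq rewrite unfold-reverse x (y ∷ ys) | eq = refl
  ... | w ∷ ws , eq rewrite unfold-reverse x (y ∷ ys) | eq =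
    cong (λ z → toℕ (lastOr y ys) <ᵇ toℕ z) (lastOr-∷ʳ w ws x)

  𝟙[m<ᵇn]+𝟙[n<ᵇm]≡1 : ∀ m n → m ≢ n → 𝟙 (m <ᵇ n) + 𝟙 (n <ᵇ m) ≡ 1
  𝟙[m<ᵇn]+𝟙[n<ᵇm]≡1 zero    zero    m≢n = ⊥-elim (m≢n refl)
  𝟙[m<ᵇn]+𝟙[n<ᵇm]≡1 zero    (suc n) _   = refl
  𝟙[m<ᵇn]+𝟙[n<ᵇm]≡1 (suc m) zero    _   = refl
  𝟙[m<ᵇn]+𝟙[n<ᵇm]≡1 (suc m) (suc n) m≢n = 𝟙[m<ᵇn]+𝟙[n<ᵇm]≡1 m n (λ m≡n → m≢n (cong suc m≡n))

  elem-lastOr : (y : Fin n) (ys : List (Fin n)) → elem (lastOr y ys) (y ∷ ys) ≡ true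
  elem-lastOr y []        rewrite ⌊≟⌋-refl y = refl
  elem-lastOr y (y′ ∷ ys) rewrite elem-lastOr y′ ys = ∨-zeroʳ ⌊ lastOr y′ ys ≟ y ⌋

  distinct⇒ends-differ : (x y : Fin n) (ys : List (Fin n)) → distinct (x ∷ y ∷ ys) ≡ true →
    toℕ x ≢ toℕ (lastOr y ys)
  distinct⇒ends-differ x y ys distinct-xs x≡last
    rewrite toℕ-injective x≡last | elem-lastOr y ys = case distinct-xs of λ ()

  paths+paths≡orderedPaths : (G : Graph n) (k : ℕ) → paths G (suc k) + paths G (suc k) ≡ orderedPaths G (suc k)
  paths+paths≡orderedPaths G k = begin
    count (isCanonPath G) Ls + count (isCanonPath G) Ls
      ≡⟨ cong (count (isCanonPath G) Ls +_)
              (sumBy-listsOfLength-involution reverse reverse-involutive length-reverse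
                                              (λ xs → 𝟙 (isCanonPath G xs)) L) ⟩
    count (isCanonPath G) Ls + sumBy (λ xs → 𝟙 (isCanonPath G (reverse xs))) Ls
      ≡⟨ sumBy-+ _ _ Ls ⟨
    sumBy (λ xs → 𝟙 (isCanonPath G xs) + 𝟙 (isCanonPath G (reverse xs))) Ls
      ≡⟨ sumBy-listsOfLength-cong L one-orientation-canonical ⟩
    count (isOrderedPath G) Ls ∎
    where
    open ≡-Reasoning
    L  = suc (suc k)
    Ls = listsOfLength L
    one-orientation-canonical : ∀ xs → length xs ≡ L →
      𝟙 (isCanonPath G xs) + 𝟙 (isCanonPath G (reverse xs)) ≡ 𝟙 (isOrderedPath G xs)
    one-orientation-canonical (x ∷ y ∷ ys) _
      rewrite distinct-reverse (x ∷ y ∷ ys) | walkB-reverse G (x ∷ y ∷ ys) | canonical-reverse x y ys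
      with distinct (x ∷ y ∷ ys) in distinct-xs | walkB G (x ∷ y ∷ ys)
    ... | false | _     = refl
    ... | true  | false = refl
    ... | true  | true  =
      𝟙[m<ᵇn]+𝟙[n<ᵇm]≡1 (toℕ x) (toℕ (lastOr y ys)) (distinct⇒ends-differ x y ys distinct-xs)

module _ {n : ℕ} where

  pn≡∑paths : (G : Graph n) → pn G ≡ sum (applyUpTo (paths G) n)
  pn≡∑paths G = sum-applyUpTo-cong n (λ k → length-filter≡count (isCanonPath G) (listsOfLength (suc k)))

  paths-0 : (G : Graph n) → paths G 0 ≡ n
  paths-0 G = trans (sumBy-listsOfLength-1 (λ xs → 𝟙 (isCanonPath G xs))) (count-allFin-true n)

  infix 4 _⊆_

  _⊆_ : Graph n → Graph n → Set
  G ⊆ H = ∀ u v → adj G u v ≡ true → adj H u v ≡ true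

  ⊆-antisym : {G H : Graph n} → G ⊆ H → H ⊆ G → ∀ u v → adj G u v ≡ adj H u v
  ⊆-antisym {G} {H} G⊆H H⊆G u v with adj G u v in Guv | adj H u v in Huv
  ... | true  | true  = refl
  ... | false | false = refl
  ... | true  | false = case trans (sym (G⊆H u v Guv)) Huv of λ ()
  ... | false | true  = case trans (sym (H⊆G u v Huv)) Guv of λ ()

  walkB-⊆ : {G H : Graph n} → G ⊆ H → ∀ xs → walkB G xs ≡ true → walkB H xs ≡ true
  walkB-⊆ G⊆H []           _ = refl
  walkB-⊆ G⊆H (x ∷ [])     _ = refl
  walkB-⊆ {G} G⊆H (x ∷ y ∷ ys) walk =
    cong₂ _∧_ (G⊆H x y (proj₁ (∧-true {adj G x y} walk)))
              (walkB-⊆ G⊆H (y ∷ ys) (proj₂ (∧-true {adj G x y} walk)))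

  isCanonPath-⊆ : {G H : Graph n} → G ⊆ H → ∀ xs → isCanonPath G xs ≡ true → isCanonPath H xs ≡ true
  isCanonPath-⊆ {G} G⊆H xs path with ∧-true {distinct xs} path
  ... | dist , rest with ∧-true {walkB G xs} rest
  ...   | walk , canon = cong₂ _∧_ dist (cong₂ _∧_ (walkB-⊆ G⊆H xs walk) canon)

  paths-⊆ : {G H : Graph n} → G ⊆ H → ∀ k → paths G k ≤ paths H k
  paths-⊆ G⊆H k = sumBy-mono (listsOfLength (suc k)) (λ xs → 𝟙-mono (isCanonPath-⊆ G⊆H xs))

  missing-edge⇒paths₁< : {G H : Graph n} {u v : Fin n} → G ⊆ H → toℕ u < toℕ v →
    adj H u v ≡ true → adj G u v ≡ false → paths G 1 < paths H 1
  missing-edge⇒paths₁< {G} {H} {u} {v} G⊆H u<v Huv Guv =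
    sumBy-listsOfLength-< 2 (u ∷ v ∷ []) (λ xs _ → 𝟙-mono (isCanonPath-⊆ G⊆H xs)) refl edge-counted-only-in-H
    where
    edge-counted-only-in-H : 𝟙 (isCanonPath G (u ∷ v ∷ [])) < 𝟙 (isCanonPath H (u ∷ v ∷ []))
    u≠v : ⌊ u ≟ v ⌋ ≡ false
    u≠v with u ≟ v
    ... | no  _    = refl
    ... | yes refl = ⊥-elim (<-irrefl refl u<v)
    edge-counted-only-in-H rewrite u≠v | Huv | Guv | <⇒<ᵇ≡true u<v = s≤s z≤n

  ⊆∧paths₁≡⇒⊇ : {G H : Graph n} → G ⊆ H → paths G 1 ≡ paths H 1 → H ⊆ G
  ⊆∧paths₁≡⇒⊇ {G} {H} G⊆H same u v Huv with adj G u v in Guv | <-cmp (toℕ u) (toℕ v)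
  ... | true  | _          = refl
  ... | false | tri< u<v _ _ = ⊥-elim (<-irrefl same (missing-edge⇒paths₁< G⊆H u<v Huv Guv))
  ... | false | tri> _ _ v<u = ⊥-elim (<-irrefl same (missing-edge⇒paths₁< G⊆H v<u
                                 (trans (Graph.sym H v u) Huv) (trans (Graph.sym G v u) Guv)))
  ... | false | tri≈ _ u≡v _ rewrite toℕ-injective u≡v = case trans (sym Huv) (irrefl H v) of λ ()

  walkB-cong : {G H : Graph n} → (∀ u v → adj G u v ≡ adj H u v) → ∀ xs → walkB G xs ≡ walkB H xs
  walkB-cong G≗H []           = refl
  walkB-cong G≗H (x ∷ [])     = refl
  walkB-cong G≗H (x ∷ y ∷ ys) = cong₂ _∧_ (G≗H x y) (walkB-cong G≗H (y ∷ ys))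

  paths-cong : {G H : Graph n} → (∀ u v → adj G u v ≡ adj H u v) → ∀ k → paths G k ≡ paths H k
  paths-cong G≗H k = sumBy-cong (listsOfLength (suc k))
    (λ xs → cong (λ w → 𝟙 (distinct xs ∧ w ∧ canonical xs)) (walkB-cong G≗H xs))

  pn-mono : {G H : Graph n} → (∀ k → paths G k ≤ paths H k) → pn G ≤ pn H
  pn-mono {G} {H} G≤H = subst₂ _≤_ (sym (pn≡∑paths G)) (sym (pn≡∑paths H)) (sum-applyUpTo-mono n G≤H)

pn≡⇒paths₁≡ : {n : ℕ} {G H : Graph n} → (∀ k → paths G k ≤ paths H k) → pn G ≡ pn H → paths G 1 ≡ paths H 1
-- For n ≤ 1 there are no two distinct vertices, and both sides are 0.
pn≡⇒paths₁≡ {zero}        _   _   = refl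
pn≡⇒paths₁≡ {suc zero}    _   _   = refl
pn≡⇒paths₁≡ {n@(suc (suc _))} {G} {H} G≤H pn≡ =
  sum-applyUpTo-≡⇒≡ n G≤H (trans (sym (pn≡∑paths G)) (trans pn≡ (pn≡∑paths H))) 1 (s≤s (s≤s z≤n))

-- Complete bipartite graphs

completeBipartite : {n : ℕ} → (Fin n → Bool) → Graph n
completeBipartite c = record
  { adj    = λ u v → c u xor c v
  ; sym    = λ u v → xor-comm (c u) (c v)
  ; irrefl = λ v → xor-same (c v)
  }

module _ {n : ℕ} (c : Fin n → Bool) where

  private
    K = completeBipartite c

  hasColour : Bool → Fin n → Bool
  hasColour b x = if b then c x else not (c x)

  startsWithColour : Bool → List (Fin n) → Bool
  startsWithColour b []      = false
  startsWithColour b (y ∷ _) = hasColour b y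

  classSize : Bool → ℕ
  classSize b = count (hasColour b) (allFin n)

  orderedPathsFrom : Bool → ℕ → ℕ
  orderedPathsFrom b k = count (λ xs → isOrderedPath K xs ∧ startsWithColour b xs) (listsOfLength (suc k))

  hasColour-neighbour : ∀ b {y y′} → adj K y y′ ≡ true → hasColour b y′ ≡ not (hasColour b y)
  hasColour-neighbour b {y} {y′} _ with c y | c y′ | b
  ... | true  | false | true  = refl
  ... | true  | false | false = refl
  ... | false | true  | true  = refl
  ... | false | true  | false = refl

  count-hasColour-walk : ∀ b y ys → walkB K (y ∷ ys) ≡ true →
    count (hasColour b) (y ∷ ys) ≡ (if hasColour b y then ⌈ suc (length ys) /2⌉ else ⌊ suc (length ys) /2⌋)
  count-hasColour-walk b y [] _ with hasColour b y
  ... | true  = refl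
  ... | false = refl
  count-hasColour-walk b y (y′ ∷ ys) walk
    rewrite count-hasColour-walk b y′ ys (proj₂ (∧-true {adj K y y′} walk))
          | hasColour-neighbour b {y} {y′} (proj₁ (∧-true {adj K y y′} walk))
    with hasColour b y
  ... | true  = refl
  ... | false = refl

  edge∧colour : ∀ b u v →
    (u xor v) ∧ (if b then u else not u) ≡ (if not b then v else not v) ∧ (if b then u else not u)
  edge∧colour true  true  true  = refl
  edge∧colour true  true  false = refl
  edge∧colour true  false true  = refl
  edge∧colour true  false false = refl
  edge∧colour false true  true  = refl
  edge∧colour false true  false = refl
  edge∧colour false false true  = refl
  edge∧colour false false false = refl

  isOrderedPath-∷-hasColour : ∀ b x y ys →
    𝟙 (isOrderedPath K (x ∷ y ∷ ys) ∧ hasColour b x) ≡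
    𝟙 (isOrderedPath K (y ∷ ys) ∧ hasColour (not b) y) * 𝟙 (hasColour b x ∧ not (elem x (y ∷ ys)))
  isOrderedPath-∷-hasColour b x y ys = begin
    𝟙 (((fresh ∧ D) ∧ ((c x xor c y) ∧ W)) ∧ hasColour b x)
      ≡⟨ cong 𝟙 (regroup₁ fresh D (c x xor c y) W (hasColour b x)) ⟩
    𝟙 (((D ∧ W) ∧ fresh) ∧ ((c x xor c y) ∧ hasColour b x))
      ≡⟨ cong (λ e → 𝟙 (((D ∧ W) ∧ fresh) ∧ e)) (edge∧colour b (c x) (c y)) ⟩
    𝟙 (((D ∧ W) ∧ fresh) ∧ (hasColour (not b) y ∧ hasColour b x))
      ≡⟨ cong 𝟙 (regroup₂ fresh (D ∧ W) (hasColour (not b) y) (hasColour b x)) ⟩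
    𝟙 (((D ∧ W) ∧ hasColour (not b) y) ∧ (hasColour b x ∧ fresh))
      ≡⟨ 𝟙-∧ ((D ∧ W) ∧ hasColour (not b) y) (hasColour b x ∧ fresh) ⟩
    𝟙 ((D ∧ W) ∧ hasColour (not b) y) * 𝟙 (hasColour b x ∧ fresh) ∎
    where
    open ≡-Reasoning
    open xor-∧-Solver
    fresh = not (elem x (y ∷ ys))
    D     = distinct (y ∷ ys)
    W     = walkB K (y ∷ ys)
    regroup₁ : ∀ f d e w h → ((f ∧ d) ∧ (e ∧ w)) ∧ h ≡ ((d ∧ w) ∧ f) ∧ (e ∧ h)
    regroup₁ = solve 5 (λ f d e w h → ((f :* d) :* (e :* w)) :* h := ((d :* w) :* f) :* (e :* h)) refl
    regroup₂ : ∀ f p y h → (p ∧ f) ∧ (y ∧ h) ≡ (p ∧ y) ∧ (h ∧ f)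
    regroup₂ = solve 4 (λ f p y h → (p :* f) :* (y :* h) := (p :* y) :* (h :* f)) refl

  hasColour-not : ∀ b y → hasColour (not b) y ≡ true → hasColour b y ≡ false
  hasColour-not true  y eq with c y
  ... | false = refl
  hasColour-not false y eq with c y
  ... | true = refl

  count-fresh : ∀ b y ys → isOrderedPath K (y ∷ ys) ≡ true → hasColour (not b) y ≡ true →
    count (λ x → hasColour b x ∧ not (elem x (y ∷ ys))) (allFin n) ≡ classSize b ∸ ⌊ suc (length ys) /2⌋
  count-fresh b y ys path colour with ∧-true {distinct (y ∷ ys)} path
  ... | dist , walk = begin
    count fresh (allFin n)
      ≡⟨ m+n∸n≡m _ (count (hasColour b) (y ∷ ys)) ⟨
    count fresh (allFin n) + count (hasColour b) (y ∷ ys) ∸ count (hasColour b) (y ∷ ys)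
      ≡⟨ cong₂ _∸_ (count-allFin-∖ (hasColour b) (y ∷ ys) dist) (count-hasColour-walk b y ys walk) ⟩
    classSize b ∸ (if hasColour b y then ⌈ suc (length ys) /2⌉ else ⌊ suc (length ys) /2⌋)
      ≡⟨ cong (λ h → classSize b ∸ (if h then ⌈ suc (length ys) /2⌉ else ⌊ suc (length ys) /2⌋))
              (hasColour-not b y colour) ⟩
    classSize b ∸ ⌊ suc (length ys) /2⌋                               ∎
    where
    open ≡-Reasoning
    fresh : Fin n → Bool
    fresh x = hasColour b x ∧ not (elem x (y ∷ ys))

  count-extensions : ∀ b y ys →
    sumBy (λ x → 𝟙 (isOrderedPath K (x ∷ y ∷ ys) ∧ hasColour b x)) (allFin n) ≡
    𝟙 (isOrderedPath K (y ∷ ys) ∧ hasColour (not b) y) * (classSize b ∸ ⌊ suc (length ys) /2⌋)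
  count-extensions b y ys = begin
    sumBy (λ x → 𝟙 (isOrderedPath K (x ∷ y ∷ ys) ∧ hasColour b x)) (allFin n)
      ≡⟨ sumBy-cong (allFin n) (λ x → isOrderedPath-∷-hasColour b x y ys) ⟩
    sumBy (λ x → 𝟙 start * 𝟙 (fresh x)) (allFin n)
      ≡⟨ sumBy-*ˡ (𝟙 start) (λ x → 𝟙 (fresh x)) (allFin n) ⟩
    𝟙 start * count fresh (allFin n)
      ≡⟨ fresh-if-start ⟩
    𝟙 start * (classSize b ∸ ⌊ suc (length ys) /2⌋) ∎
    where
    open ≡-Reasoning
    start = isOrderedPath K (y ∷ ys) ∧ hasColour (not b) y
    fresh : Fin n → Bool
    fresh x = hasColour b x ∧ not (elem x (y ∷ ys))
    fresh-if-start : 𝟙 start * count fresh (allFin n) ≡ 𝟙 start * (classSize b ∸ ⌊ suc (length ys) /2⌋)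
    fresh-if-start with isOrderedPath K (y ∷ ys) ∧ hasColour (not b) y in start≡
    ... | false = refl
    ... | true with ∧-true {isOrderedPath K (y ∷ ys)} start≡
    ...   | path , colour = cong (1 *_) (count-fresh b y ys path colour)

  orderedPathsFrom≡bipartitePathsFrom : ∀ b k →
    orderedPathsFrom b k ≡ bipartitePathsFrom (classSize true) (classSize false) b k
  orderedPathsFrom≡bipartitePathsFrom true  zero =
    sumBy-listsOfLength-1 (λ xs → 𝟙 (isOrderedPath K xs ∧ startsWithColour true xs))
  orderedPathsFrom≡bipartitePathsFrom false zero =
    sumBy-listsOfLength-1 (λ xs → 𝟙 (isOrderedPath K xs ∧ startsWithColour false xs))
  orderedPathsFrom≡bipartitePathsFrom b (suc k) = begin
    orderedPathsFrom b (suc k)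
      ≡⟨ sumBy-listsOfLength-suc {n} (λ xs → 𝟙 (isOrderedPath K xs ∧ startsWithColour b xs)) (suc k) ⟩
    sumBy (λ xs → sumBy (λ x → 𝟙 (isOrderedPath K (x ∷ xs) ∧ hasColour b x)) (allFin n)) (listsOfLength (suc k))
      ≡⟨ sumBy-listsOfLength-cong (suc k) extend ⟩
    sumBy (λ xs → 𝟙 (isOrderedPath K xs ∧ startsWithColour (not b) xs) * (classSize b ∸ ⌊ suc k /2⌋))
          (listsOfLength (suc k))
      ≡⟨ sumBy-*ʳ (classSize b ∸ ⌊ suc k /2⌋) _ (listsOfLength (suc k)) ⟩
    orderedPathsFrom (not b) k * (classSize b ∸ ⌊ suc k /2⌋)
      ≡⟨ cong (_* (classSize b ∸ ⌊ suc k /2⌋)) (orderedPathsFrom≡bipartitePathsFrom (not b) k) ⟩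
    bipartitePathsFrom (classSize true) (classSize false) (not b) k * (classSize b ∸ ⌊ suc k /2⌋)
      ≡⟨ prepend b ⟩
    bipartitePathsFrom (classSize true) (classSize false) b (suc k) ∎
    where
    open ≡-Reasoning
    extend : ∀ xs → length xs ≡ suc k →
      sumBy (λ x → 𝟙 (isOrderedPath K (x ∷ xs) ∧ hasColour b x)) (allFin n) ≡
      𝟙 (isOrderedPath K xs ∧ startsWithColour (not b) xs) * (classSize b ∸ ⌊ suc k /2⌋)
    extend (y ∷ ys) ∣y∷ys∣≡1+k = trans (count-extensions b y ys)
      (cong (λ l → 𝟙 (isOrderedPath K (y ∷ ys) ∧ hasColour (not b) y) * (classSize b ∸ ⌊ l /2⌋)) ∣y∷ys∣≡1+k)
    prepend : ∀ b →
      bipartitePathsFrom (classSize true) (classSize false) (not b) k * (classSize b ∸ ⌊ suc k /2⌋) ≡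
                    bipartitePathsFrom (classSize true) (classSize false) b (suc k)
    prepend true  = refl
    prepend false = refl

  orderedPaths≡bipartitePaths : ∀ k → orderedPaths K k ≡ bipartitePaths (classSize true) (classSize false) k
  orderedPaths≡bipartitePaths k = begin
    orderedPaths K k
      ≡⟨ sumBy-listsOfLength-cong (suc k) (λ where (y ∷ ys) _ → by-start-colour y ys) ⟩
    sumBy (λ xs → 𝟙 (isOrderedPath K xs ∧ startsWithColour true xs) +
                  𝟙 (isOrderedPath K xs ∧ startsWithColour false xs))
          (listsOfLength (suc k))
      ≡⟨ sumBy-+ _ _ (listsOfLength (suc k)) ⟩
    orderedPathsFrom true k + orderedPathsFrom false k
      ≡⟨ cong₂ _+_ (orderedPathsFrom≡bipartitePathsFrom true k) (orderedPathsFrom≡bipartitePathsFrom false k) ⟩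
    bipartitePaths (classSize true) (classSize false) k ∎
    where
    open ≡-Reasoning
    by-start-colour : ∀ y ys → 𝟙 (isOrderedPath K (y ∷ ys)) ≡
      𝟙 (isOrderedPath K (y ∷ ys) ∧ hasColour true y) + 𝟙 (isOrderedPath K (y ∷ ys) ∧ hasColour false y)
    by-start-colour y ys with isOrderedPath K (y ∷ ys) | c y
    ... | true  | true  = refl
    ... | true  | false = refl
    ... | false | _     = refl

-- Relabelling a 2-colouring

injective⇒surjective : {n : ℕ} (f : Fin n → Fin n) → (∀ u v → f u ≡ f v → u ≡ v) →
  ∀ y → Σ[ u ∈ Fin n ] f u ≡ y
injective⇒surjective {suc n} f f-inj y with any? (λ u → f u ≟ y)
... | yes hit = hit
... | no  miss = ⊥-elim (<-irrefl refl (injective⇒≤ {f = squeeze} squeeze-injective))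
  where
  y≢f : ∀ u → y ≢ f u
  y≢f u y≡fu = miss (u , sym y≡fu)
  squeeze : Fin (suc n) → Fin n
  squeeze u = punchOut (y≢f u)
  squeeze-injective : ∀ {u v} → squeeze u ≡ squeeze v → u ≡ v
  squeeze-injective eq = f-inj _ _ (punchOut-injective (y≢f _) (y≢f _) eq)

injective⇒↔ : {n : ℕ} (f : Fin n → Fin n) → (∀ u v → f u ≡ f v → u ≡ v) →
  Σ[ F ∈ Fin n ↔ Fin n ] (∀ u → Inverse.to F u ≡ f u)
injective⇒↔ f f-inj =
  mk↔ₛ′ f (λ y → proj₁ (surj y)) (λ y → proj₂ (surj y)) (λ x → f-inj _ _ (proj₂ (surj (f x)))) , λ _ → refl
  where surj = injective⇒surjective f f-inj

module _ {n : ℕ} (c : Fin n → Bool) where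

  private
    a = classSize c true

  rank : Fin n → ℕ
  rank u = count (λ v → hasColour c (c u) v ∧ (toℕ v <ᵇ toℕ u)) (allFin n)

  hasColour-self : ∀ u → hasColour c (c u) u ≡ true
  hasColour-self u with c u
  ... | true  = refl
  ... | false = refl

  not-before-self : ∀ u → hasColour c (c u) u ∧ (toℕ u <ᵇ toℕ u) ≡ false
  not-before-self u rewrite ≮⇒<ᵇ≡false (<-irrefl {toℕ u} refl) = ∧-zeroʳ _

  rank<classSize : ∀ u → rank u < classSize c (c u)
  rank<classSize u = count-allFin-< u (λ w → proj₁ ∘ ∧-true) (not-before-self u) (hasColour-self u)

  rank-< : ∀ {u v} → c u ≡ c v → toℕ u < toℕ v → rank u < rank v
  rank-< {u} {v} cu≡cv u<v = count-allFin-< u before-u⇒before-v (not-before-self u) u-before-v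
    where
    before-u⇒before-v : ∀ w → hasColour c (c u) w ∧ (toℕ w <ᵇ toℕ u) ≡ true →
                              hasColour c (c v) w ∧ (toℕ w <ᵇ toℕ v) ≡ true
    before-u⇒before-v w both with ∧-true {hasColour c (c u) w} both
    ... | same , w<u = cong₂ _∧_ (subst (λ b → hasColour c b w ≡ true) cu≡cv same)
                                 (<⇒<ᵇ≡true (<-trans (<ᵇ≡true⇒< w<u) u<v))
    u-before-v : hasColour c (c v) u ∧ (toℕ u <ᵇ toℕ v) ≡ true
    u-before-v rewrite sym cu≡cv | hasColour-self u = <⇒<ᵇ≡true u<v

  rank-injective : ∀ {u v} → c u ≡ c v → rank u ≡ rank v → u ≡ v
  rank-injective {u} {v} cu≡cv ranks≡ with <-cmp (toℕ u) (toℕ v)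
  ... | tri< u<v _ _ = ⊥-elim (<-irrefl ranks≡ (rank-< cu≡cv u<v))
  ... | tri≈ _ u≡v _ = toℕ-injective u≡v
  ... | tri> _ _ v<u = ⊥-elim (<-irrefl (sym ranks≡) (rank-< (sym cu≡cv) v<u))

  -- Colour-true vertices are numbered first, each colour class in increasing order.
  place : Bool → ℕ → ℕ
  place true  r = r
  place false r = a + r

  place<n : ∀ b {r} → r < classSize c b → place b r < n
  place<n true  r<a = ≤-trans r<a (≤-trans (m≤m+n a _) (≤-reflexive (count+count-not≡n c)))
  place<n false {r} r<b =
    ≤-trans (≤-reflexive (sym (+-suc a r))) (≤-trans (+-monoʳ-≤ a r<b) (≤-reflexive (count+count-not≡n c)))

  a+r≮a : ∀ {r} → ¬ a + r < a
  a+r≮a {r} a+r<a = <-irrefl refl (≤-trans a+r<a (m≤m+n a r))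

  place-injective : ∀ b b′ {r r′} → r < classSize c b → r′ < classSize c b′ →
    place b r ≡ place b′ r′ → b ≡ b′ × r ≡ r′
  place-injective true  true  _   _    eq = refl , eq
  place-injective false false _   _    eq = refl , +-cancelˡ-≡ a _ _ eq
  place-injective true  false r<a _    eq = ⊥-elim (a+r≮a (subst (_< a) eq r<a))
  place-injective false true  _   r<a  eq = ⊥-elim (a+r≮a (subst (_< a) (sym eq) r<a))

  place<ᵇa : ∀ b {r} → r < classSize c b → (place b r <ᵇ a) ≡ b
  place<ᵇa true  r<a = <⇒<ᵇ≡true r<a
  place<ᵇa false _   = ≮⇒<ᵇ≡false a+r≮a

  position : Fin n → Fin n
  position u = fromℕ< (place<n (c u) (rank<classSize u))

  position-injective : ∀ u v → position u ≡ position v → u ≡ v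
  position-injective u v eq with place-injective (c u) (c v) (rank<classSize u) (rank<classSize v)
    (trans (sym (toℕ-fromℕ< _)) (trans (cong toℕ eq) (toℕ-fromℕ< _)))
  ... | cu≡cv , ranks≡ = rank-injective cu≡cv ranks≡

  colour≡position<ᵇa : ∀ u → c u ≡ (toℕ (position u) <ᵇ a)
  colour≡position<ᵇa u = sym (trans (cong (_<ᵇ a) (toℕ-fromℕ< _)) (place<ᵇa (c u) (rank<classSize u)))

  completeBipartite≅KBip : completeBipartite c ≅ KBip n a
  completeBipartite≅KBip = F , λ u v → cong₂ _xor_ (colour u) (colour v)
    where
    F↔ = injective⇒↔ position position-injective
    F : Fin n ↔ Fin n
    F = proj₁ F↔
    colour : ∀ u → c u ≡ (toℕ (Inverse.to F u) <ᵇ a)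
    colour u = trans (colour≡position<ᵇa u) (cong (λ x → toℕ x <ᵇ a) (sym (proj₂ F↔ u)))

-- Comparison with K_{⌈n/2⌉,⌊n/2⌋}

≅-respˡ : {n : ℕ} {G H K : Graph n} → (∀ u v → adj G u v ≡ adj H u v) → H ≅ K → G ≅ K
≅-respˡ G≗H (F , H≅K) = F , λ u v → trans (G≗H u v) (H≅K u v)

module _ {n : ℕ} where

  threshold : Fin n → Bool
  threshold u = toℕ u <ᵇ ⌈ n /2⌉

  classSize-threshold-true : classSize threshold true ≡ ⌈ n /2⌉
  classSize-threshold-true = count-allFin-<ᵇ n ⌈ n /2⌉ (⌈n/2⌉≤n n)

  classSize-threshold-false : classSize threshold false ≡ ⌊ n /2⌋
  classSize-threshold-false = +-cancelˡ-≡ ⌈ n /2⌉ _ _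
    (trans (cong (_+ classSize threshold false) (sym classSize-threshold-true))
           (trans (count+count-not≡n threshold) (sym (⌈n/2⌉+⌊n/2⌋≡n n))))

  paths-Kbal : ∀ k → paths (Kbal n) k ≡ paths (completeBipartite threshold) k
  paths-Kbal = paths-cong (λ u v → refl)

  paths+paths-completeBipartite : (c : Fin n → Bool) → ∀ k →
    paths (completeBipartite c) (suc k) + paths (completeBipartite c) (suc k) ≡
    bipartitePaths (classSize c true) (classSize c false) (suc k)
  paths+paths-completeBipartite c k =
    trans (paths+paths≡orderedPaths _ k) (orderedPaths≡bipartitePaths c (suc k))

  paths+paths-Kbal : ∀ k →
    paths (Kbal n) (suc k) + paths (Kbal n) (suc k) ≡ bipartitePaths ⌈ n /2⌉ ⌊ n /2⌋ (suc k)
  paths+paths-Kbal k = begin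
    paths (Kbal n) (suc k) + paths (Kbal n) (suc k)
      ≡⟨ cong (λ m → m + m) (paths-Kbal (suc k)) ⟩
    paths (completeBipartite threshold) (suc k) + paths (completeBipartite threshold) (suc k)
      ≡⟨ paths+paths-completeBipartite threshold k ⟩
    bipartitePaths (classSize threshold true) (classSize threshold false) (suc k)
      ≡⟨ cong₂ (λ a b → bipartitePaths a b (suc k)) classSize-threshold-true classSize-threshold-false ⟩
    bipartitePaths ⌈ n /2⌉ ⌊ n /2⌋ (suc k) ∎
    where open ≡-Reasoning

  paths-completeBipartite≤Kbal : (c : Fin n → Bool) → ∀ k → paths (completeBipartite c) k ≤ paths (Kbal n) k
  paths-completeBipartite≤Kbal c zero    =
    ≤-reflexive (trans (paths-0 (completeBipartite c)) (sym (paths-0 (Kbal n))))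
  paths-completeBipartite≤Kbal c (suc k) = m+m≤n+n⇒m≤n (begin
    paths (completeBipartite c) (suc k) + paths (completeBipartite c) (suc k)
      ≡⟨ paths+paths-completeBipartite c k ⟩
    bipartitePaths p q (suc k)
      ≤⟨ bipartitePaths≤balanced p q (suc k) ⟩
    bipartitePaths ⌈ p + q /2⌉ ⌊ p + q /2⌋ (suc k)
      ≡⟨ cong (λ m → bipartitePaths ⌈ m /2⌉ ⌊ m /2⌋ (suc k)) (count+count-not≡n c) ⟩
    bipartitePaths ⌈ n /2⌉ ⌊ n /2⌋ (suc k)
      ≡⟨ paths+paths-Kbal k ⟨
    paths (Kbal n) (suc k) + paths (Kbal n) (suc k) ∎)
    where
    open ≤-Reasoning
    p = classSize c true
    q = classSize c false

  paths₁-completeBipartite≡Kbal⇒balanced : (c : Fin n → Bool) →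
    paths (completeBipartite c) 1 ≡ paths (Kbal n) 1 →
    classSize c true ≡ ⌈ n /2⌉ ⊎ classSize c true ≡ ⌊ n /2⌋
  paths₁-completeBipartite≡Kbal⇒balanced c edges≡ =
    subst (λ m → p ≡ ⌈ m /2⌉ ⊎ p ≡ ⌊ m /2⌋) (count+count-not≡n c)
      (m*n≡⌈m+n/2⌉*⌊m+n/2⌋⇒balanced p q (m+m≡n+n⇒m≡n (begin
        p * q + p * q
          ≡⟨ cong (_+ p * q) (*-comm p q) ⟩
        bipartitePaths p q 1
          ≡⟨ paths+paths-completeBipartite c 0 ⟨
        paths (completeBipartite c) 1 + paths (completeBipartite c) 1
          ≡⟨ cong (λ m → m + m) edges≡ ⟩
        paths (Kbal n) 1 + paths (Kbal n) 1
          ≡⟨ paths+paths-Kbal 0 ⟩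
        ⌊ n /2⌋ * ⌈ n /2⌉ + ⌈ n /2⌉ * ⌊ n /2⌋
          ≡⟨ cong (_+ ⌈ n /2⌉ * ⌊ n /2⌋) (*-comm ⌊ n /2⌋ ⌈ n /2⌉) ⟩
        ⌈ n /2⌉ * ⌊ n /2⌋ + ⌈ n /2⌉ * ⌊ n /2⌋
          ≡⟨ cong (λ m → ⌈ m /2⌉ * ⌊ m /2⌋ + ⌈ m /2⌉ * ⌊ m /2⌋) (count+count-not≡n c) ⟨
        ⌈ p + q /2⌉ * ⌊ p + q /2⌋ + ⌈ p + q /2⌉ * ⌊ p + q /2⌋ ∎)))
    where
    open ≡-Reasoning
    p = classSize c true
    q = classSize c false

  completeBipartite≅Kbal : (c : Fin n → Bool) → classSize c true ≡ ⌈ n /2⌉ ⊎ classSize c true ≡ ⌊ n /2⌋ →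
    completeBipartite c ≅ Kbal n
  completeBipartite≅Kbal c (inj₁ p≡⌈n/2⌉) =
    subst (λ a → completeBipartite c ≅ KBip n a) p≡⌈n/2⌉ (completeBipartite≅KBip c)
  completeBipartite≅Kbal c (inj₂ p≡⌊n/2⌋) =
    ≅-respˡ {G = completeBipartite c} {completeBipartite c̅} {Kbal n} (λ u v → sym (not-xor-not (c u) (c v)))
            (subst (λ a → completeBipartite c̅ ≅ KBip n a) q≡⌈n/2⌉ (completeBipartite≅KBip c̅))
    where
    c̅ : Fin n → Bool
    c̅ u = not (c u)
    q≡⌈n/2⌉ : classSize c false ≡ ⌈ n /2⌉
    q≡⌈n/2⌉ = +-cancelˡ-≡ ⌊ n /2⌋ _ _ (begin
      ⌊ n /2⌋ + classSize c false           ≡⟨ cong (_+ classSize c false) p≡⌊n/2⌋ ⟨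
      classSize c true + classSize c false  ≡⟨ count+count-not≡n c ⟩
      n                                     ≡⟨ ⌊n/2⌋+⌈n/2⌉≡n n ⟨
      ⌊ n /2⌋ + ⌈ n /2⌉                     ∎)
      where open ≡-Reasoning

mainTheorem2 : (n : ℕ) → 1 ≤ n → (G : Graph n) → Bipartite G →
  (pn G ≤ pn (Kbal n)) × (pn G ≡ pn (Kbal n) → G ≅ Kbal n)
mainTheorem2 n _ G (c , proper) = pn-mono G≤Kbal , extremal
  where
  K = completeBipartite c
  G⊆K : G ⊆ K
  G⊆K u v Guv = xor≡true (proper u v Guv)
  G≤Kbal : ∀ k → paths G k ≤ paths (Kbal n) k
  G≤Kbal k = ≤-trans (paths-⊆ G⊆K k) (paths-completeBipartite≤Kbal c k)
  extremal : pn G ≡ pn (Kbal n) → G ≅ Kbal n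
  extremal pn≡ = ≅-respˡ {G = G} {K} {Kbal n} G≗K K≅Kbal
    where
    G₁≡Kbal₁ : paths G 1 ≡ paths (Kbal n) 1
    G₁≡Kbal₁ = pn≡⇒paths₁≡ G≤Kbal pn≡
    G₁≡K₁ : paths G 1 ≡ paths K 1
    G₁≡K₁ = ≤-antisym (paths-⊆ G⊆K 1) (subst (paths K 1 ≤_) (sym G₁≡Kbal₁) (paths-completeBipartite≤Kbal c 1))
    G≗K : ∀ u v → adj G u v ≡ adj K u v
    G≗K = ⊆-antisym {G = G} {K} G⊆K (⊆∧paths₁≡⇒⊇ G⊆K G₁≡K₁)
    K≅Kbal : K ≅ Kbal n
    K≅Kbal = completeBipartite≅Kbal c (paths₁-completeBipartite≡Kbal⇒balanced c (trans (sym G₁≡K₁) G₁≡Kbal₁))
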